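{- For every integer $n>0$, \[ \sum_{k=0}^{\infty}\mathrm{pod}\!\left(n-\frac{k(k+1)}{2}\right)\equiv 0 \pmod 2. \]
   Context: $\mathrm{pod}(n)$ denotes the number of partitions of $n$ in which odd parts are distinct and even parts are unrestricted; $\sum_{n\ge0}\mathrm{pod}(n)q^n=\frac{(-q;q^2)_\infty}{(q^2;q^2)_\infty}$, where $(a;q)_\infty=\prod_{k\ge1}(1-aq^{k-1})$. Convention: $\mathrm{pod}(x)=0$ whenever $x$ is not a nonnegative integer. -}

module Defs where

open import Data.Nat using (ℕ; zero; suc; _+_; _*_; _∸_; _≤?_; _%_)
open import Data.Nat.Properties using ()
open import Data.Bool using (Bool; true; false; if_then_else_)
open import Relation.Nullary.Decidable using (⌊_⌋)
open import Data.List using (List; map; upTo)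
open import Data.Nat.ListAction using (sum)

isOdd : ℕ → Bool
isOdd n = ⌊ n % 2 Data.Nat.≟ 1 ⌋
  where import Data.Nat

-- podUpTo m n = number of partitions of n with all parts ≤ m,
-- in which odd parts are distinct and even parts are unrestricted.
-- Recursion on the largest allowed part size m: choose the multiplicity j of
-- the part (suc m); j ∈ {0,1} if suc m is odd, j unrestricted if even,
-- subject to j * suc m ≤ n (multiplicities j ≤ n suffice since suc m ≥ 1).
podUpTo : ℕ → ℕ → ℕ
podUpTo zero zero = 1
podUpTo zero (suc _) = 0
podUpTo (suc m) n =
  sum (map (λ j → if ⌊ j * suc m ≤? n ⌋
                    then podUpTo m (n ∸ j * suc m)
                    else 0)
           (upTo (if isOdd (suc m) then 2 else suc n)))

pod : ℕ → ℕ
pod n = podUpTo n n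

tri : ℕ → ℕ
tri zero = 0
tri (suc k) = tri k + suc k

-- pod extended by 0 at negative arguments: pod(n - T_k), where n - T_k < 0
-- is represented by the test T_k ≤ n.
podShift : ℕ → ℕ → ℕ
podShift n k = if ⌊ tri k ≤? n ⌋ then pod (n ∸ tri k) else 0

-- Σ_{k≥0} pod(n - k(k+1)/2); terms with k > n vanish since T_k ≥ k > n.
triSum : ℕ → ℕ
triSum n = sum (map (podShift n) (upTo (suc n)))

-- Over 𝔽₂ we have Σ pod(n) qⁿ = (−q; q²)/(q²; q²) ≡ (−q; q²)/(−q²; q²), and the triangular sum is the
-- coefficient of qⁿ in this series times ψ(q) = Σ_k q^(T_k). So it suffices that ψ(q) (−q; q²) ≡ (−q²; q²),
-- Gauss's identity mod 2. That follows from Euler's (q; q²)² (q²; q²) ≡ 1 once (−q; q²) ≡ ψ(q) (−q⁴; q⁸),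
-- which is the Jacobi triple product ∏ (1 + z q^(4n+1)) (1 + z⁻¹ q^(4n+3)) at z = 1: its functional equation
-- J(z) = zq J(zq⁴) makes the coefficient of z^j a power q^(T_k) times the constant term, and the symmetry
-- z ↦ q²/z computes that constant term. Products are taken finite and identities are proved up to a degree
-- bound, which is enough because the coefficient of qⁿ only sees the factors of degree at most n.

module Submission where

open import Defs

open import Algebra.Bundles using (AbelianGroup)
import Algebra.Construct.Pointwise as Pointwise
import Algebra.Properties.CommutativeSemigroup as CommutativeSemigroupProperties
open import Data.Nat using (ℕ; parity; >-nonZero; zero; suc; _+_; _*_; _%_; _∸_; _≤_; _<_; _≤?_; z≤n; s≤s)
open import Data.Nat.Properties
open import Data.Nat.Induction using (<-rec)
open import Data.Nat.Tactic.RingSolver using (solve-∀)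
open import Data.Parity.Base as ℙ using (Parity; 0ℙ; 1ℙ)
import Data.Parity.Properties as ℙ
open import Data.Bool using (true; false; if_then_else_)
open import Data.Bool.Properties using (if-float)
open import Data.Integer using (ℤ; +_; -[1+_]; -_) renaming (suc to sucℤ; pred to predℤ)
open import Data.Integer.Properties using () renaming (suc-pred to sucℤ-predℤ; pred-suc to predℤ-sucℤ)
open import Data.Product using (_,_)
open import Data.List using (map; upTo; applyUpTo)
open import Data.List.Properties using (map-upTo)
open import Data.Nat.ListAction using (sum)
open import Function using (_∘_)
open import Relation.Binary.Bundles using (Setoid)
import Relation.Binary.Reasoning.Setoid as SetoidReasoning
open import Relation.Binary.PropositionalEquality hiding (J)
open import Relation.Nullary using (yes; no)
open import Relation.Nullary.Decidable using (⌊_⌋)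

-- Power series over 𝔽₂

Series : Set
Series = ℕ → Parity

series-abelianGroup : AbelianGroup _ _
series-abelianGroup = Pointwise.abelianGroup ℕ ℙ.+-0-abelianGroup

open AbelianGroup series-abelianGroup using () renaming (_∙_ to _⊕_; ε to 𝟘)
open CommutativeSemigroupProperties (AbelianGroup.commutativeSemigroup series-abelianGroup)
  using (interchange)
open CommutativeSemigroupProperties ℙ.+-commutativeSemigroup
  using () renaming (interchange to ℙinterchange)

𝟙 : Series
𝟙 zero    = 1ℙ
𝟙 (suc _) = 0ℙ

+-cancel-middle : ∀ a b c → (a ℙ.+ b) ℙ.+ (b ℙ.+ c) ≡ a ℙ.+ c
+-cancel-middle a b c = begin
  (a ℙ.+ b) ℙ.+ (b ℙ.+ c)  ≡⟨ ℙ.+-assoc a b (b ℙ.+ c) ⟩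
  a ℙ.+ (b ℙ.+ (b ℙ.+ c))  ≡⟨ cong (a ℙ.+_) (ℙ.+-assoc b b c) ⟨
  a ℙ.+ ((b ℙ.+ b) ℙ.+ c)  ≡⟨ cong (λ x → a ℙ.+ (x ℙ.+ c)) (ℙ.p+p≡0ℙ b) ⟩
  a ℙ.+ c                  ∎
  where open ≡-Reasoning

infix 4 _≈[_]_
_≈[_]_ : Series → ℕ → Series → Set
f ≈[ d ] g = ∀ n → n ≤ d → f n ≡ g n

≈-setoid : ℕ → Setoid _ _
≈-setoid d = record
  { Carrier = Series
  ; _≈_ = _≈[ d ]_
  ; isEquivalence = record
    { refl  = λ _ _ → refl
    ; sym   = λ f≈g n n≤d → sym (f≈g n n≤d)
    ; trans = λ f≈g g≈h n n≤d → trans (f≈g n n≤d) (g≈h n n≤d)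
    }
  }

module ≈-Reasoning (d : ℕ) = SetoidReasoning (≈-setoid d)

module _ {d : ℕ} where
  open Setoid (≈-setoid d) public using () renaming (sym to ≈-sym; trans to ≈-trans)

≗⇒≈ : ∀ {f g d} → f ≗ g → f ≈[ d ] g
≗⇒≈ f≗g n _ = f≗g n

≈-weaken : ∀ {f g d e} → e ≤ d → f ≈[ d ] g → f ≈[ e ] g
≈-weaken e≤d f≈g n n≤e = f≈g n (≤-trans n≤e e≤d)

⊕-cong≈ : ∀ {f f′ g g′ d} → f ≈[ d ] f′ → g ≈[ d ] g′ → f ⊕ g ≈[ d ] f′ ⊕ g′
⊕-cong≈ f≈f′ g≈g′ n n≤d = cong₂ ℙ._+_ (f≈f′ n n≤d) (g≈g′ n n≤d)

infixr 8 q^_·_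
q^_·_ : ℕ → Series → Series
(q^ zero  · f) n       = f n
(q^ suc a · f) zero    = 0ℙ
(q^ suc a · f) (suc n) = (q^ a · f) n

q^·-lookup : ∀ a f n → (q^ a · f) (a + n) ≡ f n
q^·-lookup zero    f n = refl
q^·-lookup (suc a) f n = q^·-lookup a f n

q^·-below : ∀ a f {n} → n < a → (q^ a · f) n ≡ 0ℙ
q^·-below (suc a) f {zero}  _         = refl
q^·-below (suc a) f {suc n} (s≤s n<a) = q^·-below a f n<a

q^·-≤? : ∀ a f n → (q^ a · f) n ≡ (if ⌊ a ≤? n ⌋ then f (n ∸ a) else 0ℙ)
q^·-≤? a f n with a ≤? n
... | yes a≤n = trans (cong (q^ a · f) (sym (m+[n∸m]≡n a≤n))) (q^·-lookup a f (n ∸ a))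
... | no  a≰n = q^·-below a f (≰⇒> a≰n)

q^·-local : ∀ a {f g} n → (∀ m → m + a ≡ n → f m ≡ g m) → (q^ a · f) n ≡ (q^ a · g) n
q^·-local zero    n       agree = agree n (+-identityʳ n)
q^·-local (suc a) zero    agree = refl
q^·-local (suc a) (suc n) agree = q^·-local a n (λ m m+a≡n → agree m (trans (+-suc m a) (cong suc m+a≡n)))

q^·-cong : ∀ a {f g} → f ≗ g → q^ a · f ≗ q^ a · g
q^·-cong a f≗g n = q^·-local a n (λ m _ → f≗g m)

q^·-cong≈∸ : ∀ a {f g d} → f ≈[ d ∸ a ] g → q^ a · f ≈[ d ] q^ a · g
q^·-cong≈∸ a f≈g n n≤d = q^·-local a n (λ m m+a≡n → f≈g m (m+n≤o⇒m≤o∸n m (subst (_≤ _) (sym m+a≡n) n≤d)))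

q^·-cong≈ : ∀ a {f g d} → f ≈[ d ] g → q^ a · f ≈[ d ] q^ a · g
q^·-cong≈ a {d = d} f≈g = q^·-cong≈∸ a (≈-weaken (m∸n≤m d a) f≈g)

q^·-distrib-⊕ : ∀ a f g → q^ a · (f ⊕ g) ≗ q^ a · f ⊕ q^ a · g
q^·-distrib-⊕ zero    f g n       = refl
q^·-distrib-⊕ (suc a) f g zero    = refl
q^·-distrib-⊕ (suc a) f g (suc n) = q^·-distrib-⊕ a f g n

q^·-𝟘 : ∀ a → q^ a · 𝟘 ≗ 𝟘
q^·-𝟘 zero    n       = refl
q^·-𝟘 (suc a) zero    = refl
q^·-𝟘 (suc a) (suc n) = q^·-𝟘 a n

q^·-q^· : ∀ a b f → q^ a · q^ b · f ≗ q^ (a + b) · f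
q^·-q^· zero    b f n       = refl
q^·-q^· (suc a) b f zero    = refl
q^·-q^· (suc a) b f (suc n) = q^·-q^· a b f n

q^·-reassoc : ∀ a b c d f → a + b ≡ c + d → q^ a · q^ b · f ≗ q^ c · q^ d · f
q^·-reassoc a b c d f eq n = begin
  (q^ a · q^ b · f) n  ≡⟨ q^·-q^· a b f n ⟩
  (q^ (a + b) · f) n   ≡⟨ cong (λ e → (q^ e · f) n) eq ⟩
  (q^ (c + d) · f) n   ≡⟨ q^·-q^· c d f n ⟨
  (q^ c · q^ d · f) n  ∎
  where open ≡-Reasoning

q^·-comm : ∀ a b f → q^ a · q^ b · f ≗ q^ b · q^ a · f
q^·-comm a b f = q^·-reassoc a b b a f (+-comm a b)

q^·≈𝟘 : ∀ a f {d} → d < a → q^ a · f ≈[ d ] 𝟘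
q^·≈𝟘 a f d<a n n≤d = q^·-below a f (≤-<-trans n≤d d<a)

q^·-≡ : ∀ {a b} f → a ≡ b → q^ a · f ≗ q^ b · f
q^·-≡ f refl n = refl

q^·-q^·-q^· : ∀ a b c f → q^ a · q^ b · q^ c · f ≗ q^ (a + (b + c)) · f
q^·-q^·-q^· a b c f n = trans (q^·-cong a (q^·-q^· b c f) n) (q^·-q^· a (b + c) f n)

⊕-q^· : ∀ c U V n {x y} → x ≡ (q^ c · U) n → y ≡ (q^ c · V) n → x ℙ.+ y ≡ (q^ c · (U ⊕ V)) n
⊕-q^· c U V n x≡ y≡ = trans (cong₂ ℙ._+_ x≡ y≡) (sym (q^·-distrib-⊕ c U V n))

⊕-q^·𝟘 : ∀ a f → f ⊕ q^ a · 𝟘 ≗ f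
⊕-q^·𝟘 a f n = trans (cong (f n ℙ.+_) (q^·-𝟘 a n)) (ℙ.+-identityʳ (f n))

+-q^·𝟘 : ∀ a {G x} n → x ≡ 0ℙ → G ≗ 𝟘 → x ℙ.+ (q^ a · G) n ≡ 0ℙ
+-q^·𝟘 a n refl G≗𝟘 = trans (q^·-cong a G≗𝟘 n) (q^·-𝟘 a n)

q^·-⊕-q^·-⊕ : ∀ c P Q a R S n →
  (q^ c · ((P ⊕ Q) ⊕ q^ a · (R ⊕ S))) n ≡ ((q^ c · P) n ℙ.+ (q^ c · Q) n) ℙ.+ ((q^ c · q^ a · R) n ℙ.+ (q^ c · q^ a · S) n)
q^·-⊕-q^·-⊕ c P Q a R S n = trans (q^·-distrib-⊕ c (P ⊕ Q) (q^ a · (R ⊕ S)) n)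
  (cong₂ ℙ._+_ (q^·-distrib-⊕ c P Q n) (trans (q^·-cong c (q^·-distrib-⊕ a R S) n) (q^·-distrib-⊕ c (q^ a · R) (q^ a · S) n)))

infixr 8 ⟨1+q^_⟩_
⟨1+q^_⟩_ : ℕ → Series → Series
⟨1+q^ a ⟩ f = f ⊕ q^ a · f

⟨1+q^⟩-cong : ∀ a {f g} → f ≗ g → ⟨1+q^ a ⟩ f ≗ ⟨1+q^ a ⟩ g
⟨1+q^⟩-cong a f≗g n = cong₂ ℙ._+_ (f≗g n) (q^·-cong a f≗g n)

⟨1+q^⟩-cong≈ : ∀ a {f g d} → f ≈[ d ] g → ⟨1+q^ a ⟩ f ≈[ d ] ⟨1+q^ a ⟩ g
⟨1+q^⟩-cong≈ a f≈g = ⊕-cong≈ f≈g (q^·-cong≈ a f≈g)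

⟨1+q^⟩-distrib-⊕ : ∀ a f g → ⟨1+q^ a ⟩ (f ⊕ g) ≗ ⟨1+q^ a ⟩ f ⊕ ⟨1+q^ a ⟩ g
⟨1+q^⟩-distrib-⊕ a f g n = begin
  (f n ℙ.+ g n) ℙ.+ (q^ a · (f ⊕ g)) n                 ≡⟨ cong ((f n ℙ.+ g n) ℙ.+_) (q^·-distrib-⊕ a f g n) ⟩
  (f n ℙ.+ g n) ℙ.+ ((q^ a · f) n ℙ.+ (q^ a · g) n)    ≡⟨ interchange f g (q^ a · f) (q^ a · g) n ⟩
  (f n ℙ.+ (q^ a · f) n) ℙ.+ (g n ℙ.+ (q^ a · g) n)    ∎
  where open ≡-Reasoning

⟨1+q^⟩-q^· : ∀ a b f → ⟨1+q^ a ⟩ q^ b · f ≗ q^ b · ⟨1+q^ a ⟩ f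
⟨1+q^⟩-q^· a b f n = begin
  (q^ b · f) n ℙ.+ (q^ a · q^ b · f) n  ≡⟨ cong ((q^ b · f) n ℙ.+_) (q^·-comm a b f n) ⟩
  (q^ b · f) n ℙ.+ (q^ b · q^ a · f) n  ≡⟨ q^·-distrib-⊕ b f (q^ a · f) n ⟨
  (q^ b · ⟨1+q^ a ⟩ f) n                ∎
  where open ≡-Reasoning

⟨1+q^⟩-comm : ∀ a b f → ⟨1+q^ a ⟩ ⟨1+q^ b ⟩ f ≗ ⟨1+q^ b ⟩ ⟨1+q^ a ⟩ f
⟨1+q^⟩-comm a b f n = begin
  (⟨1+q^ a ⟩ (f ⊕ q^ b · f)) n                           ≡⟨ ⟨1+q^⟩-distrib-⊕ a f (q^ b · f) n ⟩
  (⟨1+q^ a ⟩ f) n ℙ.+ (⟨1+q^ a ⟩ q^ b · f) n             ≡⟨ cong ((⟨1+q^ a ⟩ f) n ℙ.+_) (⟨1+q^⟩-q^· a b f n) ⟩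
  (⟨1+q^ b ⟩ ⟨1+q^ a ⟩ f) n                              ∎
  where open ≡-Reasoning

⟨1+q^⟩-square : ∀ a f → ⟨1+q^ a ⟩ ⟨1+q^ a ⟩ f ≗ ⟨1+q^ (a + a) ⟩ f
⟨1+q^⟩-square a f n = begin
  (f n ℙ.+ (q^ a · f) n) ℙ.+ (q^ a · ⟨1+q^ a ⟩ f) n                   ≡⟨ cong ((f n ℙ.+ (q^ a · f) n) ℙ.+_) (q^·-distrib-⊕ a f (q^ a · f) n) ⟩
  (f n ℙ.+ (q^ a · f) n) ℙ.+ ((q^ a · f) n ℙ.+ (q^ a · q^ a · f) n)  ≡⟨ +-cancel-middle (f n) _ _ ⟩
  f n ℙ.+ (q^ a · q^ a · f) n                                         ≡⟨ cong (f n ℙ.+_) (q^·-q^· a a f n) ⟩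
  (⟨1+q^ (a + a) ⟩ f) n                                               ∎
  where open ≡-Reasoning

⟨1+q^⟩≈id : ∀ a f {d} → d < a → ⟨1+q^ a ⟩ f ≈[ d ] f
⟨1+q^⟩≈id a f d<a n n≤d = trans (cong (f n ℙ.+_) (q^·≈𝟘 a f d<a n n≤d)) (ℙ.+-identityʳ (f n))

⟨1+q^⟩-injective : ∀ a {f g d} → 0 < a → ⟨1+q^ a ⟩ f ≈[ d ] ⟨1+q^ a ⟩ g → f ≈[ d ] g
⟨1+q^⟩-injective a {f} {g} {d} a>0 eq = <-rec (λ n → n ≤ d → f n ≡ g n) step
  where
  step : ∀ n → (∀ {m} → m < n → m ≤ d → f m ≡ g m) → n ≤ d → f n ≡ g n
  step n ih n≤d = ℙ.+-cancelʳ-≡ ((q^ a · g) n) (f n) (g n)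
    (trans (cong (f n ℙ.+_) (sym (q^·-local a n earlier))) (eq n n≤d))
    where
    earlier : ∀ m → m + a ≡ n → f m ≡ g m
    earlier m refl = ih (m<m+n m a>0) (≤-trans (m≤m+n m a) n≤d)

∏⟨1+q^_⟩ : (ℕ → ℕ) → ℕ → Series → Series
∏⟨1+q^ g ⟩ zero    f = f
∏⟨1+q^ g ⟩ (suc L) f = ⟨1+q^ g L ⟩ ∏⟨1+q^ g ⟩ L f

∏-cong : ∀ g L {f f′} → f ≗ f′ → ∏⟨1+q^ g ⟩ L f ≗ ∏⟨1+q^ g ⟩ L f′
∏-cong g zero    f≗f′ = f≗f′
∏-cong g (suc L) f≗f′ = ⟨1+q^⟩-cong (g L) (∏-cong g L f≗f′)

∏-cong≈ : ∀ g L {f f′ d} → f ≈[ d ] f′ → ∏⟨1+q^ g ⟩ L f ≈[ d ] ∏⟨1+q^ g ⟩ L f′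
∏-cong≈ g zero    f≈f′ = f≈f′
∏-cong≈ g (suc L) f≈f′ = ⟨1+q^⟩-cong≈ (g L) (∏-cong≈ g L f≈f′)

∏-ext : ∀ {g h} L f → (∀ k → g k ≡ h k) → ∏⟨1+q^ g ⟩ L f ≗ ∏⟨1+q^ h ⟩ L f
∏-ext zero    f g≗h n = refl
∏-ext {g} {h} (suc L) f g≗h n =
  trans (cong (λ a → (⟨1+q^ a ⟩ ∏⟨1+q^ g ⟩ L f) n) (g≗h L)) (⟨1+q^⟩-cong (h L) (∏-ext L f g≗h) n)

∏-⟨1+q^⟩ : ∀ a g L f → ⟨1+q^ a ⟩ ∏⟨1+q^ g ⟩ L f ≗ ∏⟨1+q^ g ⟩ L (⟨1+q^ a ⟩ f)
∏-⟨1+q^⟩ a g zero    f n = refl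
∏-⟨1+q^⟩ a g (suc L) f n =
  trans (⟨1+q^⟩-comm a (g L) (∏⟨1+q^ g ⟩ L f) n) (⟨1+q^⟩-cong (g L) (∏-⟨1+q^⟩ a g L f) n)

∏-comm : ∀ g L h K f → ∏⟨1+q^ g ⟩ L (∏⟨1+q^ h ⟩ K f) ≗ ∏⟨1+q^ h ⟩ K (∏⟨1+q^ g ⟩ L f)
∏-comm g L h zero    f n = refl
∏-comm g L h (suc K) f n =
  trans (sym (∏-⟨1+q^⟩ (h K) g L (∏⟨1+q^ h ⟩ K f) n)) (⟨1+q^⟩-cong (h K) (∏-comm g L h K f) n)

∏-square : ∀ g L f → ∏⟨1+q^ g ⟩ L (∏⟨1+q^ g ⟩ L f) ≗ ∏⟨1+q^ (λ k → g k + g k) ⟩ L f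
∏-square g zero    f n = refl
∏-square g (suc L) f n = begin
  (⟨1+q^ g L ⟩ ∏⟨1+q^ g ⟩ L (⟨1+q^ g L ⟩ ∏⟨1+q^ g ⟩ L f)) n   ≡⟨ ⟨1+q^⟩-cong (g L) (∏-⟨1+q^⟩ (g L) g L (∏⟨1+q^ g ⟩ L f)) n ⟨
  (⟨1+q^ g L ⟩ ⟨1+q^ g L ⟩ ∏⟨1+q^ g ⟩ L (∏⟨1+q^ g ⟩ L f)) n  ≡⟨ ⟨1+q^⟩-square (g L) (∏⟨1+q^ g ⟩ L (∏⟨1+q^ g ⟩ L f)) n ⟩
  (⟨1+q^ g L + g L ⟩ ∏⟨1+q^ g ⟩ L (∏⟨1+q^ g ⟩ L f)) n        ≡⟨ ⟨1+q^⟩-cong (g L + g L) (∏-square g L f) n ⟩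
  (∏⟨1+q^ (λ k → g k + g k) ⟩ (suc L) f) n                    ∎
  where open ≡-Reasoning

double : ℕ → ℕ
double zero    = zero
double (suc n) = suc (suc (double n))

double≡+ : ∀ n → double n ≡ n + n
double≡+ zero    = refl
double≡+ (suc n) = cong suc (trans (cong suc (double≡+ n)) (sym (+-suc n n)))

double-mono-≤ : ∀ {m n} → m ≤ n → double m ≤ double n
double-mono-≤ {m} {n} m≤n = subst₂ _≤_ (sym (double≡+ m)) (sym (double≡+ n)) (+-mono-≤ m≤n m≤n)

n≤double : ∀ n → n ≤ double n
n≤double n = subst (n ≤_) (sym (double≡+ n)) (m≤m+n n n)

double-double : ∀ k → double (double k) ≡ k * 4
double-double k = trans (double≡+ (double k)) (trans (cong₂ _+_ (double≡+ k) (double≡+ k)) (arith k))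
  where
  arith : ∀ k → (k + k) + (k + k) ≡ k * 4
  arith = solve-∀

odd even : ℕ → ℕ
odd  k = suc (double k)
even k = suc (odd k)

∏-split : ∀ g L f → ∏⟨1+q^ g ⟩ (double L) f ≗ ∏⟨1+q^ g ∘ double ⟩ L (∏⟨1+q^ g ∘ suc ∘ double ⟩ L f)
∏-split g zero    f n = refl
∏-split g (suc L) f n = begin
  (⟨1+q^ g (suc (double L)) ⟩ ⟨1+q^ g (double L) ⟩ ∏⟨1+q^ g ⟩ (double L) f) n  ≡⟨ ⟨1+q^⟩-cong (g (suc (double L))) (⟨1+q^⟩-cong (g (double L)) (∏-split g L f)) n ⟩
  (⟨1+q^ g (suc (double L)) ⟩ ⟨1+q^ g (double L) ⟩ ∏⟨1+q^ g ∘ double ⟩ L rest) n  ≡⟨ ⟨1+q^⟩-comm (g (suc (double L))) (g (double L)) (∏⟨1+q^ g ∘ double ⟩ L rest) n ⟩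
  (⟨1+q^ g (double L) ⟩ ⟨1+q^ g (suc (double L)) ⟩ ∏⟨1+q^ g ∘ double ⟩ L rest) n  ≡⟨ ⟨1+q^⟩-cong (g (double L)) (∏-⟨1+q^⟩ (g (suc (double L))) (g ∘ double) L rest) n ⟩
  (∏⟨1+q^ g ∘ double ⟩ (suc L) (∏⟨1+q^ g ∘ suc ∘ double ⟩ (suc L) f)) n           ∎
  where
  open ≡-Reasoning
  rest = ∏⟨1+q^ g ∘ suc ∘ double ⟩ L f

∏-truncate : ∀ g {L L′ d} f → L ≤ L′ → (∀ k → L ≤ k → d < g k) → ∏⟨1+q^ g ⟩ L′ f ≈[ d ] ∏⟨1+q^ g ⟩ L f
∏-truncate g {L} {d = d} f L≤L′ large with m≤n⇒∃[o]m+o≡n L≤L′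
... | i , refl = extra i
  where
  extra : ∀ i → ∏⟨1+q^ g ⟩ (L + i) f ≈[ d ] ∏⟨1+q^ g ⟩ L f
  extra zero    = ≗⇒≈ (λ n → cong (λ M → ∏⟨1+q^ g ⟩ M f n) (+-identityʳ L))
  extra (suc i) = ≈-trans (≗⇒≈ (λ n → cong (λ M → ∏⟨1+q^ g ⟩ M f n) (+-suc L i)))
                          (≈-trans (⟨1+q^⟩≈id (g (L + i)) _ (large (L + i) (m≤m+n L i))) (extra i))

∏-injective : ∀ g L {f f′ d} → (∀ k → 0 < g k) → ∏⟨1+q^ g ⟩ L f ≈[ d ] ∏⟨1+q^ g ⟩ L f′ → f ≈[ d ] f′
∏-injective g zero    g>0 eq = eq
∏-injective g (suc L) g>0 eq = ∏-injective g L g>0 (⟨1+q^⟩-injective (g L) (g>0 L) eq)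

∑ : ℕ → (ℕ → Parity) → Parity
∑ zero    h = 0ℙ
∑ (suc K) h = h 0 ℙ.+ ∑ K (h ∘ suc)

∑-zero : ∀ K {h} → (∀ k → h k ≡ 0ℙ) → ∑ K h ≡ 0ℙ
∑-zero zero    h≡0 = refl
∑-zero (suc K) h≡0 = cong₂ ℙ._+_ (h≡0 0) (∑-zero K (h≡0 ∘ suc))

∑-cong : ∀ K {h h′} → (∀ k → k < K → h k ≡ h′ k) → ∑ K h ≡ ∑ K h′
∑-cong zero    h≗h′ = refl
∑-cong (suc K) h≗h′ = cong₂ ℙ._+_ (h≗h′ 0 (s≤s z≤n)) (∑-cong K (λ k k<K → h≗h′ (suc k) (s≤s k<K)))

∑-distrib-+ : ∀ K h h′ → ∑ K (λ k → h k ℙ.+ h′ k) ≡ ∑ K h ℙ.+ ∑ K h′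
∑-distrib-+ zero    h h′ = refl
∑-distrib-+ (suc K) h h′ = begin
  (h 0 ℙ.+ h′ 0) ℙ.+ ∑ K (λ k → h (suc k) ℙ.+ h′ (suc k))  ≡⟨ cong ((h 0 ℙ.+ h′ 0) ℙ.+_) (∑-distrib-+ K (h ∘ suc) (h′ ∘ suc)) ⟩
  (h 0 ℙ.+ h′ 0) ℙ.+ (∑ K (h ∘ suc) ℙ.+ ∑ K (h′ ∘ suc))   ≡⟨ ℙinterchange (h 0) (h′ 0) _ _ ⟩
  ∑ (suc K) h ℙ.+ ∑ (suc K) h′                            ∎
  where open ≡-Reasoning

∑-truncate : ∀ {B K h} → B ≤ K → (∀ k → B ≤ k → h k ≡ 0ℙ) → ∑ K h ≡ ∑ B h
∑-truncate {zero}  {K}     z≤n       h≡0 = ∑-zero K (λ k → h≡0 k z≤n)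
∑-truncate {suc B} {suc K} {h} (s≤s B≤K) h≡0 = cong (h 0 ℙ.+_) (∑-truncate B≤K (λ k B≤k → h≡0 (suc k) (s≤s B≤k)))

∑-snoc : ∀ K h → ∑ (suc K) h ≡ ∑ K h ℙ.+ h K
∑-snoc zero    h = ℙ.+-comm (h 0) 0ℙ
∑-snoc (suc K) h = trans (cong (h 0 ℙ.+_) (∑-snoc K (h ∘ suc))) (sym (ℙ.+-assoc (h 0) (∑ K (h ∘ suc)) (h (suc K))))

∑-snoc-0ℙ : ∀ K h → h K ≡ 0ℙ → ∑ (suc K) h ≡ ∑ K h
∑-snoc-0ℙ K h hK≡0 = trans (∑-snoc K h) (trans (cong (∑ K h ℙ.+_) hK≡0) (ℙ.+-identityʳ (∑ K h)))

∑-pairs : ∀ R h → ∑ (suc (double R)) h ≡ h 0 ℙ.+ ∑ R (λ t → h (odd t) ℙ.+ h (even t))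
∑-pairs zero    h = refl
∑-pairs (suc R) h = cong (h 0 ℙ.+_)
  (trans (cong (h 1 ℙ.+_) (∑-pairs R (h ∘ suc ∘ suc))) (sym (ℙ.+-assoc (h 1) (h 2) _)))

parity-sum : ∀ K h → parity (sum (map h (upTo K))) ≡ ∑ K (parity ∘ h)
parity-sum K h = trans (cong (parity ∘ sum) (map-upTo h K)) (go K h)
  where
  go : ∀ K h → parity (sum (applyUpTo h K)) ≡ ∑ K (parity ∘ h)
  go zero    h = refl
  go (suc K) h = trans (ℙ.+-homo-+ (h 0) _) (cong (parity (h 0) ℙ.+_) (go K (h ∘ suc)))

∑ˢ : ℕ → (ℕ → Series) → Series
∑ˢ K h n = ∑ K (λ k → h k n)

q^·-∑ˢ : ∀ a K h → q^ a · ∑ˢ K h ≗ ∑ˢ K (λ k → q^ a · h k)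
q^·-∑ˢ a zero    h n = q^·-𝟘 a n
q^·-∑ˢ a (suc K) h n = trans (q^·-distrib-⊕ a (h 0) (∑ˢ K (h ∘ suc)) n) (cong ((q^ a · h 0) n ℙ.+_) (q^·-∑ˢ a K (h ∘ suc) n))

∑ˢ-cong≈ : ∀ K {h h′ d} → (∀ k → k < K → h k ≈[ d ] h′ k) → ∑ˢ K h ≈[ d ] ∑ˢ K h′
∑ˢ-cong≈ K h≈h′ n n≤d = ∑-cong K (λ k k<K → h≈h′ k k<K n n≤d)

-- Summing only over k ≤ n is exact when e k ≥ k, the hypothesis k≤e below.
infixr 8 ⟨∑q^_⟩_
⟨∑q^_⟩_ : (ℕ → ℕ) → Series → Series
(⟨∑q^ e ⟩ f) n = ∑ (suc n) (λ k → (q^ e k · f) n)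

⟨∑q^⟩-cong≈ : ∀ e {f g d} → f ≈[ d ] g → ⟨∑q^ e ⟩ f ≈[ d ] ⟨∑q^ e ⟩ g
⟨∑q^⟩-cong≈ e f≈g n n≤d = ∑-cong (suc n) (λ k _ → q^·-cong≈ (e k) f≈g n n≤d)

⟨∑q^⟩-cong : ∀ e {f g} → f ≗ g → ⟨∑q^ e ⟩ f ≗ ⟨∑q^ e ⟩ g
⟨∑q^⟩-cong e f≗g n = ∑-cong (suc n) (λ k _ → q^·-cong (e k) f≗g n)

⟨∑q^⟩-distrib-⊕ : ∀ e f g → ⟨∑q^ e ⟩ (f ⊕ g) ≗ ⟨∑q^ e ⟩ f ⊕ ⟨∑q^ e ⟩ g
⟨∑q^⟩-distrib-⊕ e f g n = trans (∑-cong (suc n) (λ k _ → q^·-distrib-⊕ (e k) f g n))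
                                (∑-distrib-+ (suc n) (λ k → (q^ e k · f) n) (λ k → (q^ e k · g) n))

module _ {e : ℕ → ℕ} (k≤e : ∀ k → k ≤ e k) where

  ⟨∑q^⟩-q^· : ∀ a f → ⟨∑q^ e ⟩ q^ a · f ≗ q^ a · ⟨∑q^ e ⟩ f
  ⟨∑q^⟩-q^· a f n with a ≤? n
  ... | no a≰n = trans (∑-zero (suc n) (λ k → trans (q^·-comm (e k) a f n) (q^·-below a _ (≰⇒> a≰n))))
                       (sym (q^·-below a (⟨∑q^ e ⟩ f) (≰⇒> a≰n)))
  ... | yes a≤n with m≤n⇒∃[o]m+o≡n a≤n
  ...   | m , refl = begin
    ∑ (suc (a + m)) (λ k → (q^ e k · q^ a · f) (a + m))  ≡⟨ ∑-cong (suc (a + m)) (λ k _ → shift-out k) ⟩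
    ∑ (suc (a + m)) (λ k → (q^ e k · f) m)               ≡⟨ ∑-truncate (s≤s (m≤n+m m a)) vanish ⟩
    (⟨∑q^ e ⟩ f) m                                       ≡⟨ q^·-lookup a (⟨∑q^ e ⟩ f) m ⟨
    (q^ a · ⟨∑q^ e ⟩ f) (a + m)                          ∎
    where
    open ≡-Reasoning
    shift-out : ∀ k → (q^ e k · q^ a · f) (a + m) ≡ (q^ e k · f) m
    shift-out k = trans (q^·-comm (e k) a f (a + m)) (q^·-lookup a (q^ e k · f) m)
    vanish : ∀ k → suc m ≤ k → (q^ e k · f) m ≡ 0ℙ
    vanish k m<k = q^·-below (e k) f (≤-trans m<k (k≤e k))

  ⟨∑q^⟩-⟨1+q^⟩ : ∀ a f → ⟨∑q^ e ⟩ ⟨1+q^ a ⟩ f ≗ ⟨1+q^ a ⟩ ⟨∑q^ e ⟩ f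
  ⟨∑q^⟩-⟨1+q^⟩ a f n = trans (⟨∑q^⟩-distrib-⊕ e f (q^ a · f) n) (cong ((⟨∑q^ e ⟩ f) n ℙ.+_) (⟨∑q^⟩-q^· a f n))

  ⟨∑q^⟩-∏ : ∀ g L f → ⟨∑q^ e ⟩ ∏⟨1+q^ g ⟩ L f ≗ ∏⟨1+q^ g ⟩ L (⟨∑q^ e ⟩ f)
  ⟨∑q^⟩-∏ g zero    f n = refl
  ⟨∑q^⟩-∏ g (suc L) f n = trans (⟨∑q^⟩-⟨1+q^⟩ (g L) (∏⟨1+q^ g ⟩ L f) n) (⟨1+q^⟩-cong (g L) (⟨∑q^⟩-∏ g L f) n)

⟨1+q^⟩-geometric : ∀ a f → 0 < a → ⟨1+q^ a ⟩ ⟨∑q^ (_* a) ⟩ f ≗ f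
⟨1+q^⟩-geometric a f a>0 n = begin
  (f n ℙ.+ S n) ℙ.+ (q^ a · ⟨∑q^ (_* a) ⟩ f) n        ≡⟨ cong ((f n ℙ.+ S n) ℙ.+_) (⟨∑q^⟩-q^· k≤k*a a f n) ⟨
  (f n ℙ.+ S n) ℙ.+ (⟨∑q^ (_* a) ⟩ q^ a · f) n        ≡⟨ cong ((f n ℙ.+ S n) ℙ.+_) tail ⟨
  (f n ℙ.+ S n) ℙ.+ S n                              ≡⟨ ℙ.+-assoc (f n) (S n) (S n) ⟩
  f n ℙ.+ (S n ℙ.+ S n)                              ≡⟨ cong (f n ℙ.+_) (ℙ.p+p≡0ℙ (S n)) ⟩
  f n ℙ.+ 0ℙ                                         ≡⟨ ℙ.+-identityʳ (f n) ⟩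
  f n                                                ∎
  where
  open ≡-Reasoning
  k≤k*a : ∀ k → k ≤ k * a
  k≤k*a k = m≤m*n k a {{>-nonZero a>0}}
  S : Series
  S n = ∑ n (λ j → (q^ (a + j * a) · f) n)
  tail : S n ≡ (⟨∑q^ (_* a) ⟩ q^ a · f) n
  tail = trans (∑-cong n (λ j _ → trans (cong (λ x → (q^ x · f) n) (+-comm a (j * a))) (sym (q^·-q^· (j * a) a f n)))) (sym (∑-truncate (n≤1+n n) vanish))
    where
    vanish : ∀ j → n ≤ j → (q^ (j * a) · q^ a · f) n ≡ 0ℙ
    vanish j n≤j = trans (q^·-q^· (j * a) a f n) (q^·-below (j * a + a) f (≤-<-trans (≤-trans n≤j (k≤k*a j)) (m<m+n (j * a) a>0)))

k≤tri : ∀ k → k ≤ tri k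
k≤tri zero    = z≤n
k≤tri (suc k) = subst (suc k ≤_) (sym (+-suc (tri k) k)) (s≤s (m≤n+m k (tri k)))

-- Euler's and Gauss's identities mod 2

fourOdd : ℕ → ℕ
fourOdd k = (odd k + odd k) + (odd k + odd k)

module OddEven (L : ℕ) where

  O E : Series → Series
  O = ∏⟨1+q^ odd ⟩ L
  E = ∏⟨1+q^ even ⟩ L

  O-E-comm : ∀ f → O (E f) ≗ E (O f)
  O-E-comm f = ∏-comm odd L even L f

  E-O²-comm : ∀ f → E (O (O f)) ≗ O (O (E f))
  E-O²-comm f n = trans (sym (O-E-comm (O f) n)) (∏-cong odd L (λ m → sym (O-E-comm f m)) n)

  private
    D : Series → Series
    D = ∏⟨1+q^ suc ⟩ (double L)

    D≗OE : ∀ f → D f ≗ O (E f)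
    D≗OE = ∏-split suc L

    D²≈E : ∀ f → D (D f) ≈[ double L ] E f
    D²≈E f = begin
      D (D f)                                          ≈⟨ ≗⇒≈ (∏-square suc (double L) f) ⟩
      ∏⟨1+q^ (λ k → suc k + suc k) ⟩ (double L) f      ≈⟨ ∏-truncate _ f (n≤double L) large ⟩
      ∏⟨1+q^ (λ k → suc k + suc k) ⟩ L f               ≈⟨ ≗⇒≈ (∏-ext L f 2[k+1]≡even) ⟩
      E f                                              ∎
      where
      open ≈-Reasoning (double L)
      large : ∀ k → L ≤ k → double L < suc k + suc k
      large k L≤k = subst (_< suc k + suc k) (sym (double≡+ L)) (s≤s (+-mono-≤ L≤k (m≤n⇒m≤1+n L≤k)))
      2[k+1]≡even : ∀ k → suc k + suc k ≡ even k
      2[k+1]≡even k = cong suc (trans (+-suc k k) (cong suc (sym (double≡+ k))))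

  -- D = ∏_{1 ≤ k ≤ 2L} (1 + q^k) is O E and D² ≡ E; cancelling D in D ≡ D (O D) leaves O D = O² E ≡ 1.
  euler : ∀ f → O (O (E f)) ≈[ double L ] f
  euler f = ≈-trans (≗⇒≈ (∏-cong odd L (λ n → sym (D≗OE f n)))) (≈-sym f≈ODf)
    where
    f≈ODf : f ≈[ double L ] O (D f)
    f≈ODf = ∏-injective suc (double L) (λ _ → s≤s z≤n) (begin
      D f            ≈⟨ ≗⇒≈ (D≗OE f) ⟩
      O (E f)        ≈⟨ ∏-cong≈ odd L (D²≈E f) ⟨
      O (D (D f))    ≈⟨ ≗⇒≈ (∏-comm odd L suc (double L) (D f)) ⟩
      D (O (D f))    ∎)
      where open ≈-Reasoning (double L)

  private
    O⁴ : ∀ f → O (O (O (O f))) ≗ ∏⟨1+q^ fourOdd ⟩ L f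
    O⁴ f n = begin
      O (O (O (O f))) n                                    ≡⟨ ∏-square odd L (O (O f)) n ⟩
      ∏⟨1+q^ twoOdd ⟩ L (O (O f)) n                        ≡⟨ ∏-cong twoOdd L (∏-square odd L f) n ⟩
      ∏⟨1+q^ twoOdd ⟩ L (∏⟨1+q^ twoOdd ⟩ L f) n            ≡⟨ ∏-square twoOdd L f n ⟩
      ∏⟨1+q^ fourOdd ⟩ L f n                               ∎
      where
      open ≡-Reasoning
      twoOdd : ℕ → ℕ
      twoOdd k = odd k + odd k

    E²O⁴≗O²EO²E : ∀ x → E (E (O (O (O (O x))))) ≗ O (O (E (O (O (E x)))))
    E²O⁴≗O²EO²E x n = begin
      E (E (O (O (O (O x))))) n   ≡⟨ ∏-cong even L (E-O²-comm (O (O x))) n ⟩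
      E (O (O (E (O (O x))))) n   ≡⟨ E-O²-comm (E (O (O x))) n ⟩
      O (O (E (E (O (O x))))) n   ≡⟨ ∏-cong odd L (∏-cong odd L (∏-cong even L (E-O²-comm x))) n ⟩
      O (O (E (O (O (E x))))) n   ∎
      where open ≡-Reasoning

    O-E²-O : ∀ x → O (E (E (O x))) ≗ E (O (O (E x)))
    O-E²-O x n = begin
      O (E (E (O x))) n    ≡⟨ O-E-comm (E (O x)) n ⟩
      E (O (E (O x))) n    ≡⟨ ∏-cong even L (O-E-comm (O x)) n ⟩
      E (E (O (O x))) n    ≡⟨ ∏-cong even L (E-O²-comm x) n ⟩
      E (O (O (E x))) n    ∎
      where open ≡-Reasoning

  -- Euler's identity O² E ≡ 1 turns the hypothesis O ≡ ψ O⁴ into E² O ≡ ψ, whence O ψ ≡ E (O² E) ≡ E.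
  gauss : O 𝟙 ≈[ double L ] ⟨∑q^ tri ⟩ ∏⟨1+q^ fourOdd ⟩ L 𝟙 → O (⟨∑q^ tri ⟩ 𝟙) ≈[ double L ] E 𝟙
  gauss triple-product = begin
    O p                 ≈⟨ ∏-cong≈ odd L E²O𝟙≈p ⟨
    O (E (E (O 𝟙)))     ≈⟨ ≗⇒≈ (O-E²-O 𝟙) ⟩
    E (O (O (E 𝟙)))     ≈⟨ ∏-cong≈ even L (euler 𝟙) ⟩
    E 𝟙                 ∎
    where
    open ≈-Reasoning (double L)
    p = ⟨∑q^ tri ⟩ 𝟙
    O𝟙≈O⁴p : O 𝟙 ≈[ double L ] O (O (O (O p)))
    O𝟙≈O⁴p = ≈-trans triple-product (≗⇒≈ (λ n → trans (⟨∑q^⟩-∏ k≤tri fourOdd L 𝟙 n) (sym (O⁴ p n))))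
    E²O𝟙≈p : E (E (O 𝟙)) ≈[ double L ] p
    E²O𝟙≈p = begin
      E (E (O 𝟙))                  ≈⟨ ∏-cong≈ even L (∏-cong≈ even L O𝟙≈O⁴p) ⟩
      E (E (O (O (O (O p)))))      ≈⟨ ≗⇒≈ (E²O⁴≗O²EO²E p) ⟩
      O (O (E (O (O (E p)))))      ≈⟨ euler (O (O (E p))) ⟩
      O (O (E p))                  ≈⟨ euler p ⟩
      p                            ∎

-- The Jacobi triple product mod 2

Laurent : Set
Laurent = ℤ → Series

infix 4 _≐_ _≐[_]_
_≐_ : Laurent → Laurent → Set
F ≐ G = ∀ j → F j ≗ G j

_≐[_]_ : Laurent → ℕ → Laurent → Set
F ≐[ d ] G = ∀ j → F j ≈[ d ] G j

𝟙ᶻ : Laurent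
𝟙ᶻ (+ zero)  = 𝟙
𝟙ᶻ (+ suc _) = 𝟘
𝟙ᶻ -[1+ _ ]  = 𝟘

infixr 8 ⟨1+zq^_⟩_ ⟨1+z⁻¹q^_⟩_
⟨1+zq^_⟩_ : ℕ → Laurent → Laurent
(⟨1+zq^ a ⟩ F) j = F j ⊕ q^ a · F (predℤ j)

⟨1+z⁻¹q^_⟩_ : ℕ → Laurent → Laurent
(⟨1+z⁻¹q^ b ⟩ F) j = F j ⊕ q^ b · F (sucℤ j)

⟨1+zq^⟩-cong : ∀ a {F G} → F ≐ G → ⟨1+zq^ a ⟩ F ≐ ⟨1+zq^ a ⟩ G
⟨1+zq^⟩-cong a F≐G j n = cong₂ ℙ._+_ (F≐G j n) (q^·-cong a (F≐G (predℤ j)) n)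

⟨1+zq^⟩-cong≈ : ∀ a {F G d} → F ≐[ d ] G → ⟨1+zq^ a ⟩ F ≐[ d ] ⟨1+zq^ a ⟩ G
⟨1+zq^⟩-cong≈ a F≈G j = ⊕-cong≈ (F≈G j) (q^·-cong≈ a (F≈G (predℤ j)))

⟨1+zq^⟩≈id : ∀ a F {d} → d < a → ⟨1+zq^ a ⟩ F ≐[ d ] F
⟨1+zq^⟩≈id a F d<a j n n≤d = trans (cong (F j n ℙ.+_) (q^·≈𝟘 a (F (predℤ j)) d<a n n≤d)) (ℙ.+-identityʳ (F j n))

⟨1+z⁻¹q^⟩≈id : ∀ b F {d} → d < b → ⟨1+z⁻¹q^ b ⟩ F ≐[ d ] F
⟨1+z⁻¹q^⟩≈id b F d<b j n n≤d = trans (cong (F j n ℙ.+_) (q^·≈𝟘 b (F (sucℤ j)) d<b n n≤d)) (ℙ.+-identityʳ (F j n))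

⟨1+zq^⟩-⟨1+z⁻¹q^⟩-comm : ∀ a b F → ⟨1+zq^ a ⟩ ⟨1+z⁻¹q^ b ⟩ F ≐ ⟨1+z⁻¹q^ b ⟩ ⟨1+zq^ a ⟩ F
⟨1+zq^⟩-⟨1+z⁻¹q^⟩-comm a b F j n = begin
  (F j n ℙ.+ (q^ b · F (sucℤ j)) n) ℙ.+ (q^ a · (F (predℤ j) ⊕ q^ b · F (sucℤ (predℤ j)))) n
    ≡⟨ cong ((F j n ℙ.+ (q^ b · F (sucℤ j)) n) ℙ.+_) (q^·-distrib-⊕ a (F (predℤ j)) (q^ b · F (sucℤ (predℤ j))) n) ⟩
  (F j n ℙ.+ (q^ b · F (sucℤ j)) n) ℙ.+ ((q^ a · F (predℤ j)) n ℙ.+ (q^ a · q^ b · F (sucℤ (predℤ j))) n)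
    ≡⟨ ℙinterchange (F j n) _ _ _ ⟩
  (F j n ℙ.+ (q^ a · F (predℤ j)) n) ℙ.+ ((q^ b · F (sucℤ j)) n ℙ.+ (q^ a · q^ b · F (sucℤ (predℤ j))) n)
    ≡⟨ cong (λ x → (F j n ℙ.+ (q^ a · F (predℤ j)) n) ℙ.+ ((q^ b · F (sucℤ j)) n ℙ.+ x)) (same-corner (sucℤ-predℤ j) (predℤ-sucℤ j)) ⟩
  (F j n ℙ.+ (q^ a · F (predℤ j)) n) ℙ.+ ((q^ b · F (sucℤ j)) n ℙ.+ (q^ b · q^ a · F (predℤ (sucℤ j))) n)
    ≡⟨ cong ((F j n ℙ.+ (q^ a · F (predℤ j)) n) ℙ.+_) (q^·-distrib-⊕ b (F (sucℤ j)) (q^ a · F (predℤ (sucℤ j))) n) ⟨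
  (F j n ℙ.+ (q^ a · F (predℤ j)) n) ℙ.+ (q^ b · (F (sucℤ j) ⊕ q^ a · F (predℤ (sucℤ j)))) n
    ∎
  where
  open ≡-Reasoning
  same-corner : sucℤ (predℤ j) ≡ j → predℤ (sucℤ j) ≡ j →
                (q^ a · q^ b · F (sucℤ (predℤ j))) n ≡ (q^ b · q^ a · F (predℤ (sucℤ j))) n
  same-corner sp ps rewrite sp | ps = q^·-comm a b (F j) n

4n+1 4n+3 : ℕ → ℕ
4n+1 n = suc (n * 4)
4n+3 n = suc (suc (4n+1 n))

J⁻ : ℕ → Laurent
J⁻ zero    = 𝟙ᶻ
J⁻ (suc M) = ⟨1+z⁻¹q^ 4n+3 M ⟩ J⁻ M

J⁺ : ℕ → Laurent → Laurent
J⁺ zero    F = F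
J⁺ (suc N) F = ⟨1+zq^ 4n+1 N ⟩ J⁺ N F

J : ℕ → ℕ → Laurent
J N M = J⁺ N (J⁻ M)

J⁺-⟨1+z⁻¹q^⟩ : ∀ N b F → J⁺ N (⟨1+z⁻¹q^ b ⟩ F) ≐ ⟨1+z⁻¹q^ b ⟩ J⁺ N F
J⁺-⟨1+z⁻¹q^⟩ zero    b F j n = refl
J⁺-⟨1+z⁻¹q^⟩ (suc N) b F j n =
  trans (⟨1+zq^⟩-cong (4n+1 N) (J⁺-⟨1+z⁻¹q^⟩ N b F) j n) (⟨1+zq^⟩-⟨1+z⁻¹q^⟩-comm (4n+1 N) b (J⁺ N F) j n)

predℤ-neg : ∀ m → predℤ (- (+ m)) ≡ -[1+ m ]
predℤ-neg zero    = refl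
predℤ-neg (suc m) = refl

sucℤ-negsuc : ∀ m → sucℤ -[1+ m ] ≡ - (+ m)
sucℤ-negsuc zero    = refl
sucℤ-negsuc (suc m) = refl

-- H(z) = zq·F(zq⁴), stated coefficientwise.
record FunctionalEquation (F H : Laurent) : Set where
  field
    nonnegative : ∀ t → H (+ suc t) ≗ q^ 4n+1 t · F (+ t)
    negative    : ∀ m → F -[1+ m ] ≗ q^ 4n+3 m · H (- (+ m))
open FunctionalEquation

FE-cong : ∀ {F F′ H H′} → F ≐ F′ → H ≐ H′ → FunctionalEquation F H → FunctionalEquation F′ H′
nonnegative (FE-cong F≐F′ H≐H′ fe) t n =
  trans (sym (H≐H′ (+ suc t) n)) (trans (nonnegative fe t n) (q^·-cong (4n+1 t) (F≐F′ (+ t)) n))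
negative    (FE-cong F≐F′ H≐H′ fe) m n =
  trans (sym (F≐F′ -[1+ m ] n)) (trans (negative fe m n) (q^·-cong (4n+3 m) (H≐H′ (- (+ m))) n))

FE-⟨1+zq^⟩ : ∀ a {F H} → FunctionalEquation F H → FunctionalEquation (⟨1+zq^ a ⟩ F) (⟨1+zq^ (4 + a) ⟩ H)
nonnegative (FE-⟨1+zq^⟩ a {F} {H} fe) zero n = ⊕-q^· 1 (F (+ 0)) (q^ a · F -[1+ 0 ]) n (nonnegative fe 0 n) (begin
  (q^ (4 + a) · H (+ 0)) n            ≡⟨ q^·-≡ (H (+ 0)) (arith a) n ⟩
  (q^ (1 + (a + 3)) · H (+ 0)) n      ≡⟨ q^·-q^·-q^· 1 a 3 (H (+ 0)) n ⟨
  (q^ 1 · q^ a · q^ 3 · H (+ 0)) n    ≡⟨ q^·-cong 1 (q^·-cong a (negative fe 0)) n ⟨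
  (q^ 1 · q^ a · F -[1+ 0 ]) n        ∎)
  where
  open ≡-Reasoning
  arith : ∀ a → 4 + a ≡ 1 + (a + 3)
  arith = solve-∀
nonnegative (FE-⟨1+zq^⟩ a {F} {H} fe) (suc t) n =
  ⊕-q^· (4n+1 (suc t)) (F (+ suc t)) (q^ a · F (+ t)) n (nonnegative fe (suc t) n) (begin
  (q^ (4 + a) · H (+ suc t)) n                ≡⟨ q^·-cong (4 + a) (nonnegative fe t) n ⟩
  (q^ (4 + a) · q^ 4n+1 t · F (+ t)) n        ≡⟨ q^·-reassoc (4 + a) (4n+1 t) (4n+1 (suc t)) a (F (+ t)) (arith a t) n ⟩
  (q^ 4n+1 (suc t) · q^ a · F (+ t)) n        ∎)
  where
  open ≡-Reasoning
  arith : ∀ a t → (4 + a) + suc (t * 4) ≡ suc (4 + t * 4) + a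
  arith = solve-∀
negative (FE-⟨1+zq^⟩ a {F} {H} fe) m n =
  ⊕-q^· (4n+3 m) (H (- (+ m))) (q^ (4 + a) · H (predℤ (- (+ m)))) n (negative fe m n) (begin
  (q^ a · F -[1+ suc m ]) n                            ≡⟨ q^·-cong a (negative fe (suc m)) n ⟩
  (q^ a · q^ 4n+3 (suc m) · H -[1+ m ]) n              ≡⟨ q^·-reassoc a (4n+3 (suc m)) (4n+3 m) (4 + a) (H -[1+ m ]) (arith a m) n ⟩
  (q^ 4n+3 m · q^ (4 + a) · H -[1+ m ]) n              ≡⟨ cong (λ j → (q^ 4n+3 m · q^ (4 + a) · H j) n) (predℤ-neg m) ⟨
  (q^ 4n+3 m · q^ (4 + a) · H (predℤ (- (+ m)))) n     ∎)
  where
  open ≡-Reasoning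
  arith : ∀ a m → a + (3 + (4 + m * 4)) ≡ (3 + m * 4) + (4 + a)
  arith = solve-∀

FE-⟨1+z⁻¹q^⟩ : ∀ b {F H} → FunctionalEquation F H → FunctionalEquation (⟨1+z⁻¹q^ (4 + b) ⟩ F) (⟨1+z⁻¹q^ b ⟩ H)
nonnegative (FE-⟨1+z⁻¹q^⟩ b {F} {H} fe) t n =
  ⊕-q^· (4n+1 t) (F (+ t)) (q^ (4 + b) · F (+ suc t)) n (nonnegative fe t n) (begin
  (q^ b · H (+ suc (suc t))) n                  ≡⟨ q^·-cong b (nonnegative fe (suc t)) n ⟩
  (q^ b · q^ 4n+1 (suc t) · F (+ suc t)) n      ≡⟨ q^·-reassoc b (4n+1 (suc t)) (4n+1 t) (4 + b) (F (+ suc t)) (arith b t) n ⟩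
  (q^ 4n+1 t · q^ (4 + b) · F (+ suc t)) n      ∎)
  where
  open ≡-Reasoning
  arith : ∀ b t → b + suc (4 + t * 4) ≡ suc (t * 4) + (4 + b)
  arith = solve-∀
negative (FE-⟨1+z⁻¹q^⟩ b {F} {H} fe) zero n = ⊕-q^· 3 (H (+ 0)) (q^ b · H (+ 1)) n (negative fe 0 n) (begin
  (q^ (4 + b) · F (+ 0)) n            ≡⟨ q^·-≡ (F (+ 0)) (arith b) n ⟩
  (q^ (3 + (b + 1)) · F (+ 0)) n      ≡⟨ q^·-q^·-q^· 3 b 1 (F (+ 0)) n ⟨
  (q^ 3 · q^ b · q^ 1 · F (+ 0)) n    ≡⟨ q^·-cong 3 (q^·-cong b (nonnegative fe 0)) n ⟨
  (q^ 3 · q^ b · H (+ 1)) n           ∎)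
  where
  open ≡-Reasoning
  arith : ∀ b → 4 + b ≡ 3 + (b + 1)
  arith = solve-∀
negative (FE-⟨1+z⁻¹q^⟩ b {F} {H} fe) (suc m) n =
  ⊕-q^· (4n+3 (suc m)) (H -[1+ m ]) (q^ b · H (sucℤ -[1+ m ])) n (negative fe (suc m) n) (begin
  (q^ (4 + b) · F -[1+ m ]) n                    ≡⟨ q^·-cong (4 + b) (negative fe m) n ⟩
  (q^ (4 + b) · q^ 4n+3 m · H (- (+ m))) n       ≡⟨ q^·-reassoc (4 + b) (4n+3 m) (4n+3 (suc m)) b (H (- (+ m))) (arith b m) n ⟩
  (q^ 4n+3 (suc m) · q^ b · H (- (+ m))) n       ≡⟨ cong (λ j → (q^ 4n+3 (suc m) · q^ b · H j) n) (sucℤ-negsuc m) ⟨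
  (q^ 4n+3 (suc m) · q^ b · H (sucℤ -[1+ m ])) n ∎)
  where
  open ≡-Reasoning
  arith : ∀ b m → (4 + b) + (3 + m * 4) ≡ (3 + (4 + m * 4)) + b
  arith = solve-∀

FE-J₀₁ : FunctionalEquation (J 0 1) (J 1 0)
nonnegative FE-J₀₁ zero    n = sym (q^·-cong 1 (⊕-q^·𝟘 3 𝟙) n)
nonnegative FE-J₀₁ (suc t) n = trans (q^·-𝟘 1 n) (sym (trans (q^·-cong (4n+1 (suc t)) (⊕-q^·𝟘 3 𝟘) n) (q^·-𝟘 (4n+1 (suc t)) n)))
negative    FE-J₀₁ zero    n = sym (q^·-cong 3 (⊕-q^·𝟘 1 𝟙) n)
negative    FE-J₀₁ (suc m) n = trans (q^·-𝟘 3 n) (sym (trans (q^·-cong (4n+3 (suc m)) (⊕-q^·𝟘 1 𝟘) n) (q^·-𝟘 (4n+3 (suc m)) n)))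

FE-J : ∀ N M → FunctionalEquation (J N (suc M)) (J (suc N) M)
FE-J zero    zero    = FE-J₀₁
FE-J zero    (suc M) = FE-cong (λ _ _ → refl) (λ j n → sym (⟨1+zq^⟩-⟨1+z⁻¹q^⟩-comm 1 (4n+3 M) (J⁻ M) j n))
                               (FE-⟨1+z⁻¹q^⟩ (4n+3 M) (FE-J zero M))
FE-J (suc N) M       = FE-⟨1+zq^⟩ (4n+1 N) (FE-J N M)

-- e⁺ t = T_{2t−1} and e⁻ m = T_{2m} are the q-exponents attached to z^t and z^(−m).
e⁺ e⁻ : ℕ → ℕ
e⁺ zero    = 0
e⁺ (suc t) = 4n+1 t + e⁺ t
e⁻ zero    = 0
e⁻ (suc m) = 4n+3 m + e⁻ m

J-coefficient⁺ : ∀ t N M → J (t + N) M (+ t) ≗ q^ e⁺ t · J N (t + M) (+ 0)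
J-coefficient⁺ zero    N M n = refl
J-coefficient⁺ (suc t) N M n = begin
  J (suc t + N) M (+ suc t) n                        ≡⟨ nonnegative (FE-J (t + N) M) t n ⟩
  (q^ 4n+1 t · J (t + N) (suc M) (+ t)) n            ≡⟨ q^·-cong (4n+1 t) (J-coefficient⁺ t N (suc M)) n ⟩
  (q^ 4n+1 t · q^ e⁺ t · J N (t + suc M) (+ 0)) n    ≡⟨ q^·-q^· (4n+1 t) (e⁺ t) (J N (t + suc M) (+ 0)) n ⟩
  (q^ e⁺ (suc t) · J N (t + suc M) (+ 0)) n          ≡⟨ cong (λ M′ → (q^ e⁺ (suc t) · J N M′ (+ 0)) n) (+-suc t M) ⟩
  (q^ e⁺ (suc t) · J N (suc t + M) (+ 0)) n          ∎
  where open ≡-Reasoning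

J-coefficient⁻ : ∀ m N M → J N (m + M) (- (+ m)) ≗ q^ e⁻ m · J (m + N) M (+ 0)
J-coefficient⁻ zero    N M n = refl
J-coefficient⁻ (suc m) N M n = begin
  J N (suc m + M) -[1+ m ] n                         ≡⟨ negative (FE-J N (m + M)) m n ⟩
  (q^ 4n+3 m · J (suc N) (m + M) (- (+ m))) n        ≡⟨ q^·-cong (4n+3 m) (J-coefficient⁻ m (suc N) M) n ⟩
  (q^ 4n+3 m · q^ e⁻ m · J (m + suc N) M (+ 0)) n    ≡⟨ q^·-q^· (4n+3 m) (e⁻ m) (J (m + suc N) M (+ 0)) n ⟩
  (q^ e⁻ (suc m) · J (m + suc N) M (+ 0)) n          ≡⟨ cong (λ N′ → (q^ e⁻ (suc m) · J N′ M (+ 0)) n) (+-suc m N) ⟩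
  (q^ e⁻ (suc m) · J (suc m + N) M (+ 0)) n          ∎
  where open ≡-Reasoning

e⁺≡tri : ∀ t → e⁺ (suc t) ≡ tri (odd t)
e⁺≡tri zero    = refl
e⁺≡tri (suc t) = begin
  4n+1 (suc t) + e⁺ (suc t)                                     ≡⟨ cong (λ x → 4n+1 (suc t) + x) (e⁺≡tri t) ⟩
  suc (4 + t * 4) + tri (odd t)                                 ≡⟨ cong (λ x → suc (4 + t * 4) + tri (suc x)) (double≡+ t) ⟩
  suc (4 + t * 4) + tri (suc (t + t))                           ≡⟨ arith t (tri (suc (t + t))) ⟩
  (tri (suc (t + t)) + suc (suc (t + t))) + suc (suc (suc (t + t))) ≡⟨ cong (λ x → (tri (suc x) + suc (suc x)) + suc (suc (suc x))) (double≡+ t) ⟨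
  tri (odd (suc t))                                             ∎
  where
  open ≡-Reasoning
  arith : ∀ t T → suc (4 + t * 4) + T ≡ (T + suc (suc (t + t))) + suc (suc (suc (t + t)))
  arith = solve-∀

e⁻≡tri : ∀ m → e⁻ (suc m) ≡ tri (even m)
e⁻≡tri zero    = refl
e⁻≡tri (suc m) = begin
  4n+3 (suc m) + e⁻ (suc m)                                     ≡⟨ cong (λ x → 4n+3 (suc m) + x) (e⁻≡tri m) ⟩
  suc (suc (suc (4 + m * 4))) + tri (even m)                    ≡⟨ cong (λ x → suc (suc (suc (4 + m * 4))) + tri (suc (suc x))) (double≡+ m) ⟩
  suc (suc (suc (4 + m * 4))) + tri (suc (suc (m + m)))         ≡⟨ arith m (tri (suc (suc (m + m)))) ⟩
  (tri (suc (suc (m + m))) + suc (suc (suc (m + m)))) + suc (suc (suc (suc (m + m)))) ≡⟨ cong (λ x → (tri (suc (suc x)) + suc (suc (suc x))) + suc (suc (suc (suc x)))) (double≡+ m) ⟨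
  tri (even (suc m))                                            ∎
  where
  open ≡-Reasoning
  arith : ∀ m T → suc (suc (suc (4 + m * 4))) + T ≡ (T + suc (suc (suc (m + m)))) + suc (suc (suc (suc (m + m))))
  arith = solve-∀

n≤e⁺ : ∀ t → t ≤ e⁺ t
n≤e⁺ zero    = z≤n
n≤e⁺ (suc t) = +-mono-≤ (s≤s z≤n) (n≤e⁺ t)

n≤e⁻ : ∀ m → m ≤ e⁻ m
n≤e⁻ zero    = z≤n
n≤e⁻ (suc m) = +-mono-≤ (s≤s z≤n) (n≤e⁻ m)

J⁻-above : ∀ M t → J⁻ M (+ suc t) ≗ 𝟘
J⁻-above zero    t n = refl
J⁻-above (suc M) t n = +-q^·𝟘 (4n+3 M) n (J⁻-above M t n) (J⁻-above M (suc t))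

J⁻-below : ∀ M m → M ≤ m → J⁻ M -[1+ m ] ≗ 𝟘
J⁻-below zero    m       _         n = refl
J⁻-below (suc M) (suc m) (s≤s M≤m) n =
  +-q^·𝟘 (4n+3 M) n (J⁻-below M (suc m) (m≤n⇒m≤1+n M≤m) n) (J⁻-below M m M≤m)

J-above : ∀ N M s → N < s → J N M (+ s) ≗ 𝟘
J-above zero    M (suc t) _         = J⁻-above M t
J-above (suc N) M (suc s) (s≤s N<s) n =
  +-q^·𝟘 (4n+1 N) n (J-above N M (suc s) (m≤n⇒m≤1+n N<s) n) (J-above N M s N<s)

J-below : ∀ N M m → M ≤ m → J N M -[1+ m ] ≗ 𝟘
J-below zero    M m M≤m = J⁻-below M m M≤m
J-below (suc N) M m M≤m n =
  +-q^·𝟘 (4n+1 N) n (J-below N M m M≤m n) (J-below N M (suc m) (m≤n⇒m≤1+n M≤m))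

-- Σ_{−R ≤ j < R} F_j: the value at z = 1 of a Laurent polynomial supported in that window.
atOne : ℕ → Laurent → Series
atOne R F = ∑ˢ R (λ t → F (+ t)) ⊕ ∑ˢ R (λ m → F -[1+ m ])

atOne-⊕ : ∀ R F G → atOne R (λ j → F j ⊕ G j) ≗ atOne R F ⊕ atOne R G
atOne-⊕ R F G n = trans (cong₂ ℙ._+_ (∑-distrib-+ R (λ t → F (+ t) n) (λ t → G (+ t) n))
                                     (∑-distrib-+ R (λ m → F -[1+ m ] n) (λ m → G -[1+ m ] n)))
                        (ℙinterchange (∑ R (λ t → F (+ t) n)) (∑ R (λ t → G (+ t) n)) (∑ R (λ m → F -[1+ m ] n)) (∑ R (λ m → G -[1+ m ] n)))

atOne-q^· : ∀ R a F → atOne R (λ j → q^ a · F j) ≗ q^ a · atOne R F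
atOne-q^· R a F n = sym (trans (q^·-distrib-⊕ a (∑ˢ R (λ t → F (+ t))) (∑ˢ R (λ m → F -[1+ m ])) n)
                               (cong₂ ℙ._+_ (q^·-∑ˢ a R (λ t → F (+ t)) n) (q^·-∑ˢ a R (λ m → F -[1+ m ]) n)))

atOne-predℤ : ∀ R F → F (+ R) ≗ 𝟘 → F -[1+ suc R ] ≗ 𝟘 → atOne (suc R) (F ∘ predℤ) ≗ atOne (suc R) F
atOne-predℤ R F top bottom n = begin
  (x ℙ.+ A) ℙ.+ ∑ (suc R) (λ m → F -[1+ suc m ] n)   ≡⟨ cong ((x ℙ.+ A) ℙ.+_) (∑-snoc-0ℙ R _ (bottom n)) ⟩
  (x ℙ.+ A) ℙ.+ B                                    ≡⟨ cong (ℙ._+ B) (ℙ.+-comm x A) ⟩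
  (A ℙ.+ x) ℙ.+ B                                    ≡⟨ ℙ.+-assoc A x B ⟩
  A ℙ.+ (x ℙ.+ B)                                    ≡⟨ cong (ℙ._+ (x ℙ.+ B)) (∑-snoc-0ℙ R _ (top n)) ⟨
  ∑ (suc R) (λ t → F (+ t) n) ℙ.+ (x ℙ.+ B)          ∎
  where
  open ≡-Reasoning
  x = F -[1+ 0 ] n
  A = ∑ R (λ t → F (+ t) n)
  B = ∑ R (λ m → F -[1+ suc m ] n)

atOne-sucℤ : ∀ R F → F (+ suc R) ≗ 𝟘 → F -[1+ R ] ≗ 𝟘 → atOne (suc R) (F ∘ sucℤ) ≗ atOne (suc R) F
atOne-sucℤ R F top bottom n = begin
  ∑ (suc R) (λ t → F (+ suc t) n) ℙ.+ (x ℙ.+ B)      ≡⟨ cong (ℙ._+ (x ℙ.+ B)) (∑-snoc-0ℙ R _ (top n)) ⟩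
  A ℙ.+ (x ℙ.+ B)                                    ≡⟨ ℙ.+-assoc A x B ⟨
  (A ℙ.+ x) ℙ.+ B                                    ≡⟨ cong (ℙ._+ B) (ℙ.+-comm A x) ⟩
  (x ℙ.+ A) ℙ.+ B                                    ≡⟨ cong ((x ℙ.+ A) ℙ.+_) (∑-snoc-0ℙ R _ (bottom n)) ⟨
  (x ℙ.+ A) ℙ.+ ∑ (suc R) (λ m → F -[1+ m ] n)       ∎
  where
  open ≡-Reasoning
  x = F (+ 0) n
  A = ∑ R (λ t → F (+ suc t) n)
  B = ∑ R (λ m → F -[1+ m ] n)

atOne-⟨1+zq^⟩ : ∀ R a F → F (+ R) ≗ 𝟘 → F -[1+ suc R ] ≗ 𝟘 → atOne (suc R) (⟨1+zq^ a ⟩ F) ≗ ⟨1+q^ a ⟩ atOne (suc R) F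
atOne-⟨1+zq^⟩ R a F top bottom n =
  trans (atOne-⊕ (suc R) F (λ j → q^ a · F (predℤ j)) n)
        (cong (atOne (suc R) F n ℙ.+_) (trans (atOne-q^· (suc R) a (F ∘ predℤ) n) (q^·-cong a (atOne-predℤ R F top bottom) n)))

atOne-⟨1+z⁻¹q^⟩ : ∀ R b F → F (+ suc R) ≗ 𝟘 → F -[1+ R ] ≗ 𝟘 → atOne (suc R) (⟨1+z⁻¹q^ b ⟩ F) ≗ ⟨1+q^ b ⟩ atOne (suc R) F
atOne-⟨1+z⁻¹q^⟩ R b F top bottom n =
  trans (atOne-⊕ (suc R) F (λ j → q^ b · F (sucℤ j)) n)
        (cong (atOne (suc R) F n ℙ.+_) (trans (atOne-q^· (suc R) b (F ∘ sucℤ) n) (q^·-cong b (atOne-sucℤ R F top bottom) n)))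

atOne-J⁻ : ∀ {R} M → M ≤ R → atOne (suc R) (J⁻ M) ≗ ∏⟨1+q^ 4n+3 ⟩ M 𝟙
atOne-J⁻ {R} zero _ n =
  trans (cong₂ ℙ._+_ (cong (𝟙 n ℙ.+_) (∑-zero R (λ _ → refl))) (∑-zero (suc R) (λ _ → refl)))
        (trans (ℙ.+-identityʳ _) (ℙ.+-identityʳ (𝟙 n)))
atOne-J⁻ {R} (suc M) M<R n =
  trans (atOne-⟨1+z⁻¹q^⟩ R (4n+3 M) (J⁻ M) (J⁻-above M R) (J⁻-below M R (<⇒≤ M<R)) n)
        (⟨1+q^⟩-cong (4n+3 M) (atOne-J⁻ M (<⇒≤ M<R)) n)

atOne-J : ∀ {R} N M → N ≤ R → M ≤ R → atOne (suc R) (J N M) ≗ ∏⟨1+q^ 4n+1 ⟩ N (∏⟨1+q^ 4n+3 ⟩ M 𝟙)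
atOne-J zero    M _   M≤R = atOne-J⁻ M M≤R
atOne-J {R} (suc N) M N<R M≤R n =
  trans (atOne-⟨1+zq^⟩ R (4n+1 N) (J N M) (J-above N M R N<R) (J-below N M (suc R) (m≤n⇒m≤1+n M≤R)) n)
        (⟨1+q^⟩-cong (4n+1 N) (atOne-J N M (<⇒≤ N<R) M≤R) n)

c<4n+1 : ∀ c i → c < 4n+1 (c + i)
c<4n+1 c i = s≤s (≤-trans (m≤m+n c i) (m≤m*n (c + i) 4))

J⁺-cong≈ : ∀ N {F G d} → F ≐[ d ] G → J⁺ N F ≐[ d ] J⁺ N G
J⁺-cong≈ zero    F≈G = F≈G
J⁺-cong≈ (suc N) F≈G = ⟨1+zq^⟩-cong≈ (4n+1 N) (J⁺-cong≈ N F≈G)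

J⁺-truncate : ∀ {c N} F → c ≤ N → J⁺ N F ≐[ c ] J⁺ c F
J⁺-truncate {c} F c≤N with m≤n⇒∃[o]m+o≡n c≤N
... | i , refl = extra i
  where
  extra : ∀ i → J⁺ (c + i) F ≐[ c ] J⁺ c F
  extra zero    j n n≤c = cong (λ N → J⁺ N F j n) (+-identityʳ c)
  extra (suc i) j n n≤c = trans (cong (λ N → J⁺ N F j n) (+-suc c i))
    (trans (⟨1+zq^⟩≈id (4n+1 (c + i)) (J⁺ (c + i) F) (c<4n+1 c i) j n n≤c) (extra i j n n≤c))

J⁻-truncate : ∀ {c M} → c ≤ M → J⁻ M ≐[ c ] J⁻ c
J⁻-truncate {c} c≤M with m≤n⇒∃[o]m+o≡n c≤M
... | i , refl = extra i
  where
  extra : ∀ i → J⁻ (c + i) ≐[ c ] J⁻ c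
  extra zero    j n n≤c = cong (λ M → J⁻ M j n) (+-identityʳ c)
  extra (suc i) j n n≤c = trans (cong (λ M → J⁻ M j n) (+-suc c i))
    (trans (⟨1+z⁻¹q^⟩≈id (4n+3 (c + i)) (J⁻ (c + i)) (m≤n⇒m≤1+n (m≤n⇒m≤1+n (c<4n+1 c i))) j n n≤c) (extra i j n n≤c))

J-truncate : ∀ {c N M} → c ≤ N → c ≤ M → J N M ≐[ c ] J c c
J-truncate {c} {N} {M} c≤N c≤M j = ≈-trans (J⁺-truncate (J⁻ M) c≤N j) (J⁺-cong≈ c (J⁻-truncate c≤M) j)

-- F(q²/z) = F(z), coefficientwise.
Symmetric : Laurent → Set
Symmetric F = ∀ m → F -[1+ m ] ≗ q^ even m · F (+ suc m)

Symmetric-cong : ∀ {F G} → F ≐ G → Symmetric F → Symmetric G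
Symmetric-cong F≐G sym-F m n = trans (sym (F≐G -[1+ m ] n)) (trans (sym-F m n) (q^·-cong (even m) (F≐G (+ suc m)) n))

Symmetric-step : ∀ a F → Symmetric F → Symmetric (⟨1+zq^ a ⟩ ⟨1+z⁻¹q^ (2 + a) ⟩ F)
Symmetric-step a F sym-F m n = begin
  (F -[1+ m ] n ℙ.+ (q^ b · F (sucℤ -[1+ m ])) n) ℙ.+ (q^ a · (F -[1+ suc m ] ⊕ q^ b · F -[1+ m ])) n
    ≡⟨ cong ((F -[1+ m ] n ℙ.+ (q^ b · F (sucℤ -[1+ m ])) n) ℙ.+_) (q^·-distrib-⊕ a (F -[1+ suc m ]) (q^ b · F -[1+ m ]) n) ⟩
  (F -[1+ m ] n ℙ.+ (q^ b · F (sucℤ -[1+ m ])) n) ℙ.+ ((q^ a · F -[1+ suc m ]) n ℙ.+ (q^ a · q^ b · F -[1+ m ]) n)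
    ≡⟨ cong₂ ℙ._+_ (cong₂ ℙ._+_ (sym-F m n) (middle m)) (cong₂ ℙ._+_ outer corner) ⟩
  ((q^ c · F (+ suc m)) n ℙ.+ (q^ c · q^ a · F (+ m)) n) ℙ.+ ((q^ c · q^ b · F (+ suc (suc m))) n ℙ.+ (q^ c · q^ a · q^ b · F (+ suc m)) n)
    ≡⟨ ℙinterchange ((q^ c · F (+ suc m)) n) ((q^ c · q^ a · F (+ m)) n) ((q^ c · q^ b · F (+ suc (suc m))) n) ((q^ c · q^ a · q^ b · F (+ suc m)) n) ⟩
  ((q^ c · F (+ suc m)) n ℙ.+ (q^ c · q^ b · F (+ suc (suc m))) n) ℙ.+ ((q^ c · q^ a · F (+ m)) n ℙ.+ (q^ c · q^ a · q^ b · F (+ suc m)) n)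
    ≡⟨ q^·-⊕-q^·-⊕ c (F (+ suc m)) (q^ b · F (+ suc (suc m))) a (F (+ m)) (q^ b · F (+ suc m)) n ⟨
  (q^ c · (⟨1+zq^ a ⟩ ⟨1+z⁻¹q^ b ⟩ F) (+ suc m)) n
    ∎
  where
  open ≡-Reasoning
  b = 2 + a
  c = even m
  middle : ∀ m → (q^ b · F (sucℤ -[1+ m ])) n ≡ (q^ even m · q^ a · F (+ m)) n
  middle zero     = sym (q^·-q^· 2 a (F (+ 0)) n)
  middle (suc m′) = trans (q^·-cong b (sym-F m′) n) (q^·-reassoc b (even m′) (even (suc m′)) a (F (+ suc m′)) (arith a (double m′)) n)
    where
    arith : ∀ a x → (2 + a) + (2 + x) ≡ (2 + (2 + x)) + a
    arith = solve-∀
  outer : (q^ a · F -[1+ suc m ]) n ≡ (q^ c · q^ b · F (+ suc (suc m))) n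
  outer = trans (q^·-cong a (sym-F (suc m)) n) (q^·-reassoc a (even (suc m)) c b (F (+ suc (suc m))) (arith a (double m)) n)
    where
    arith : ∀ a x → a + (4 + x) ≡ (2 + x) + (2 + a)
    arith = solve-∀
  corner : (q^ a · q^ b · F -[1+ m ]) n ≡ (q^ c · q^ a · q^ b · F (+ suc m)) n
  corner = begin
    (q^ a · q^ b · F -[1+ m ]) n                 ≡⟨ q^·-cong a (q^·-cong b (sym-F m)) n ⟩
    (q^ a · q^ b · q^ c · F (+ suc m)) n         ≡⟨ q^·-q^·-q^· a b c (F (+ suc m)) n ⟩
    (q^ (a + (b + c)) · F (+ suc m)) n           ≡⟨ q^·-≡ (F (+ suc m)) (arith a b c) n ⟩
    (q^ (c + (a + b)) · F (+ suc m)) n           ≡⟨ q^·-q^·-q^· c a b (F (+ suc m)) n ⟨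
    (q^ c · q^ a · q^ b · F (+ suc m)) n         ∎
    where
    arith : ∀ a b c → a + (b + c) ≡ c + (a + b)
    arith = solve-∀

-- In the constant term the two cross terms q^a F₋₁ and q^(a+2) F₁ cancel.
constant-step : ∀ a F → Symmetric F → (⟨1+zq^ a ⟩ ⟨1+z⁻¹q^ (2 + a) ⟩ F) (+ 0) ≗ ⟨1+q^ (a + (2 + a)) ⟩ F (+ 0)
constant-step a F sym-F n = begin
  (F (+ 0) n ℙ.+ (q^ b · F (+ 1)) n) ℙ.+ (q^ a · (F -[1+ 0 ] ⊕ q^ b · F (+ 0))) n
    ≡⟨ cong ((F (+ 0) n ℙ.+ (q^ b · F (+ 1)) n) ℙ.+_) (q^·-distrib-⊕ a (F -[1+ 0 ]) (q^ b · F (+ 0)) n) ⟩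
  (F (+ 0) n ℙ.+ (q^ b · F (+ 1)) n) ℙ.+ ((q^ a · F -[1+ 0 ]) n ℙ.+ (q^ a · q^ b · F (+ 0)) n)
    ≡⟨ cong (λ x → (F (+ 0) n ℙ.+ (q^ b · F (+ 1)) n) ℙ.+ (x ℙ.+ (q^ a · q^ b · F (+ 0)) n)) cross ⟩
  (F (+ 0) n ℙ.+ (q^ b · F (+ 1)) n) ℙ.+ ((q^ b · F (+ 1)) n ℙ.+ (q^ a · q^ b · F (+ 0)) n)
    ≡⟨ +-cancel-middle (F (+ 0) n) _ _ ⟩
  F (+ 0) n ℙ.+ (q^ a · q^ b · F (+ 0)) n
    ≡⟨ cong (F (+ 0) n ℙ.+_) (q^·-q^· a b (F (+ 0)) n) ⟩
  (⟨1+q^ (a + b) ⟩ F (+ 0)) n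
    ∎
  where
  open ≡-Reasoning
  b = 2 + a
  cross : (q^ a · F -[1+ 0 ]) n ≡ (q^ b · F (+ 1)) n
  cross = trans (q^·-cong a (sym-F 0) n) (trans (q^·-q^· a 2 (F (+ 1)) n) (q^·-≡ (F (+ 1)) (+-comm a 2) n))

J-suc-suc : ∀ L → J (suc L) (suc L) ≐ ⟨1+zq^ 4n+1 L ⟩ ⟨1+z⁻¹q^ 4n+3 L ⟩ J L L
J-suc-suc L = ⟨1+zq^⟩-cong (4n+1 L) (J⁺-⟨1+z⁻¹q^⟩ L (4n+3 L) (J⁻ L))

J-symmetric : ∀ L → Symmetric (J L L)
J-symmetric zero    m n = sym (q^·-𝟘 (even m) n)
J-symmetric (suc L) = Symmetric-cong (λ j n → sym (J-suc-suc L j n)) (Symmetric-step (4n+1 L) (J L L) (J-symmetric L))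

fourOdd≡ : ∀ k → 4n+1 k + (2 + 4n+1 k) ≡ fourOdd k
fourOdd≡ k = trans (arith k) (cong (λ x → (suc x + suc x) + (suc x + suc x)) (sym (double≡+ k)))
  where
  arith : ∀ k → suc (k * 4) + (2 + suc (k * 4)) ≡ (suc (k + k) + suc (k + k)) + (suc (k + k) + suc (k + k))
  arith = solve-∀

J-constant : ∀ L → J L L (+ 0) ≗ ∏⟨1+q^ fourOdd ⟩ L 𝟙
J-constant zero    n = refl
J-constant (suc L) n = begin
  J (suc L) (suc L) (+ 0) n                                    ≡⟨ J-suc-suc L (+ 0) n ⟩
  (⟨1+zq^ 4n+1 L ⟩ ⟨1+z⁻¹q^ 4n+3 L ⟩ J L L) (+ 0) n            ≡⟨ constant-step (4n+1 L) (J L L) (J-symmetric L) n ⟩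
  (⟨1+q^ (4n+1 L + (2 + 4n+1 L)) ⟩ J L L (+ 0)) n              ≡⟨ cong (λ a → (⟨1+q^ a ⟩ J L L (+ 0)) n) (fourOdd≡ L) ⟩
  (⟨1+q^ fourOdd L ⟩ J L L (+ 0)) n                            ≡⟨ ⟨1+q^⟩-cong (fourOdd L) (J-constant L) n ⟩
  (∏⟨1+q^ fourOdd ⟩ (suc L) 𝟙) n                               ∎
  where open ≡-Reasoning

e⁺-e⁻-triangles : ∀ R g → ∑ˢ (suc R) (λ t → q^ e⁺ t · g) ⊕ ∑ˢ R (λ m → q^ e⁻ (suc m) · g)
                        ≗ ∑ˢ (suc (double R)) (λ k → q^ tri k · g)
e⁺-e⁻-triangles R g n = begin
  (g n ℙ.+ ∑ R (λ t → (q^ e⁺ (suc t) · g) n)) ℙ.+ ∑ R (λ m → (q^ e⁻ (suc m) · g) n)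
    ≡⟨ cong₂ (λ x y → (g n ℙ.+ x) ℙ.+ y) (∑-cong R (λ t _ → cong (λ e → (q^ e · g) n) (e⁺≡tri t)))
                                         (∑-cong R (λ m _ → cong (λ e → (q^ e · g) n) (e⁻≡tri m))) ⟩
  (g n ℙ.+ ∑ R (h ∘ odd)) ℙ.+ ∑ R (h ∘ even)
    ≡⟨ ℙ.+-assoc (g n) (∑ R (h ∘ odd)) (∑ R (h ∘ even)) ⟩
  g n ℙ.+ (∑ R (h ∘ odd) ℙ.+ ∑ R (h ∘ even))
    ≡⟨ cong (g n ℙ.+_) (∑-distrib-+ R (h ∘ odd) (h ∘ even)) ⟨
  g n ℙ.+ ∑ R (λ t → h (odd t) ℙ.+ h (even t))
    ≡⟨ ∑-pairs R h ⟨
  ∑ (suc (double R)) h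
    ∎
  where
  open ≡-Reasoning
  h = λ k → (q^ tri k · g) n

-- At z = 1: by the functional equation the coefficient of z^j is q^(T_k) times the constant term (−q⁴; q⁸),
-- and these T_k run over all triangular numbers.
jacobi : ∀ L → ∏⟨1+q^ odd ⟩ L 𝟙 ≈[ double L ] ⟨∑q^ tri ⟩ ∏⟨1+q^ fourOdd ⟩ L 𝟙
jacobi L = begin
  ∏⟨1+q^ odd ⟩ L 𝟙                                                    ≈⟨ ∏-truncate odd 𝟙 L≤double-d odd-large ⟨
  ∏⟨1+q^ odd ⟩ (double d) 𝟙                                           ≈⟨ ≗⇒≈ odd-split ⟩
  ∏⟨1+q^ 4n+1 ⟩ d (∏⟨1+q^ 4n+3 ⟩ d 𝟙)                                 ≈⟨ ≗⇒≈ (atOne-J d d ≤-refl ≤-refl) ⟨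
  atOne (suc d) F                                                     ≈⟨ ≗⇒≈ drop-last ⟩
  ∑ˢ (suc d) (λ t → F (+ t)) ⊕ ∑ˢ d (λ m → F -[1+ m ])                ≈⟨ ⊕-cong≈ (∑ˢ-cong≈ (suc d) positive-coefficient) (∑ˢ-cong≈ d negative-coefficient) ⟩
  ∑ˢ (suc d) (λ t → q^ e⁺ t · g₀) ⊕ ∑ˢ d (λ m → q^ e⁻ (suc m) · g₀)  ≈⟨ ≗⇒≈ (e⁺-e⁻-triangles d g₀) ⟩
  ∑ˢ (suc (double d)) (λ k → q^ tri k · g₀)                           ≈⟨ all-triangles ⟩
  ⟨∑q^ tri ⟩ g₀                                                       ≈⟨ ⟨∑q^⟩-cong≈ tri g₀≈ ⟩
  ⟨∑q^ tri ⟩ ∏⟨1+q^ fourOdd ⟩ L 𝟙                                     ∎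
  where
  open ≈-Reasoning (double L)
  d = double L
  F = J d d
  g₀ = F (+ 0)

  L≤double-d : L ≤ double d
  L≤double-d = ≤-trans (n≤double L) (n≤double d)

  odd-large : ∀ k → L ≤ k → d < odd k
  odd-large k L≤k = s≤s (double-mono-≤ L≤k)

  odd-split : ∏⟨1+q^ odd ⟩ (double d) 𝟙 ≗ ∏⟨1+q^ 4n+1 ⟩ d (∏⟨1+q^ 4n+3 ⟩ d 𝟙)
  odd-split n = trans (∏-split odd d 𝟙 n) (trans (∏-ext d _ (λ k → cong suc (double-double k)) n)
                      (∏-cong 4n+1 d (∏-ext d 𝟙 (λ k → cong (suc ∘ suc ∘ suc) (double-double k))) n))

  drop-last : atOne (suc d) F ≗ ∑ˢ (suc d) (λ t → F (+ t)) ⊕ ∑ˢ d (λ m → F -[1+ m ])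
  drop-last n = cong (∑ˢ (suc d) (λ t → F (+ t)) n ℙ.+_) (∑-snoc-0ℙ d _ (J-below d d d ≤-refl n))

  constant-term-stable : ∀ {c N M} → c ≤ N → c ≤ M → c ≤ d → J N M (+ 0) ≈[ c ] g₀
  constant-term-stable c≤N c≤M c≤d = ≈-trans (J-truncate c≤N c≤M (+ 0)) (≈-sym (J-truncate c≤d c≤d (+ 0)))

  positive-coefficient : ∀ t → t < suc d → F (+ t) ≈[ d ] q^ e⁺ t · g₀
  positive-coefficient t (s≤s t≤d) = ≈-trans (≗⇒≈ coefficient) (q^·-cong≈∸ (e⁺ t) (≈-weaken (∸-monoʳ-≤ d (n≤e⁺ t)) stable))
    where
    coefficient : F (+ t) ≗ q^ e⁺ t · J (d ∸ t) (t + d) (+ 0)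
    coefficient n = trans (cong (λ N → J N d (+ t) n) (sym (m+[n∸m]≡n t≤d))) (J-coefficient⁺ t (d ∸ t) d n)
    stable : J (d ∸ t) (t + d) (+ 0) ≈[ d ∸ t ] g₀
    stable = constant-term-stable ≤-refl (≤-trans (m∸n≤m d t) (m≤n+m d t)) (m∸n≤m d t)

  negative-coefficient : ∀ m → m < d → F -[1+ m ] ≈[ d ] q^ e⁻ (suc m) · g₀
  negative-coefficient m s≤d = ≈-trans (≗⇒≈ coefficient) (q^·-cong≈∸ (e⁻ (suc m)) (≈-weaken (∸-monoʳ-≤ d (n≤e⁻ (suc m))) stable))
    where
    coefficient : F -[1+ m ] ≗ q^ e⁻ (suc m) · J (suc m + d) (d ∸ suc m) (+ 0)
    coefficient n = trans (cong (λ M → J d M -[1+ m ] n) (sym (m+[n∸m]≡n s≤d))) (J-coefficient⁻ (suc m) d (d ∸ suc m) n)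
    stable : J (suc m + d) (d ∸ suc m) (+ 0) ≈[ d ∸ suc m ] g₀
    stable = constant-term-stable (≤-trans (m∸n≤m d (suc m)) (m≤n+m d (suc m))) ≤-refl (m∸n≤m d (suc m))

  all-triangles : ∑ˢ (suc (double d)) (λ k → q^ tri k · g₀) ≈[ d ] ⟨∑q^ tri ⟩ g₀
  all-triangles n n≤d = ∑-truncate (s≤s (≤-trans n≤d (n≤double d))) (λ k n<k → q^·-below (tri k) g₀ (≤-trans n<k (k≤tri k)))

  g₀≈ : g₀ ≈[ d ] ∏⟨1+q^ fourOdd ⟩ L 𝟙
  g₀≈ = ≈-trans (≗⇒≈ (J-constant d)) (∏-truncate fourOdd 𝟙 (n≤double L) fourOdd-large)
    where
    fourOdd-large : ∀ k → L ≤ k → d < fourOdd k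
    fourOdd-large k L≤k = ≤-trans (s≤s (double-mono-≤ L≤k)) (≤-trans (m≤m+n (odd k) (odd k)) (m≤m+n _ _))

-- The parity of pod

podParity : ℕ → Series
podParity m n = parity (podUpTo m n)

podParity-zero : podParity 0 ≗ 𝟙
podParity-zero zero    = refl
podParity-zero (suc n) = refl

-- Summand j of podUpTo (suc m) n counts the partitions with exactly j parts equal to suc m.
podParity-suc : ∀ m n →
  podParity (suc m) n ≡ ∑ (if isOdd (suc m) then 2 else suc n) (λ j → (q^ (j * suc m) · podParity m) n)
podParity-suc m n = trans (parity-sum bound _) (∑-cong bound (λ j _ → summand j))
  where
  bound = if isOdd (suc m) then 2 else suc n
  summand : ∀ j → parity (if ⌊ j * suc m ≤? n ⌋ then podUpTo m (n ∸ j * suc m) else 0)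
                ≡ (q^ (j * suc m) · podParity m) n
  summand j = trans (if-float parity ⌊ j * suc m ≤? n ⌋) (sym (q^·-≤? (j * suc m) (podParity m) n))

podParity-odd : ∀ m → isOdd (suc m) ≡ true → podParity (suc m) ≗ ⟨1+q^ suc m ⟩ podParity m
podParity-odd m odd-part n = begin
  podParity (suc m) n                                              ≡⟨ podParity-suc m n ⟩
  ∑ (if isOdd (suc m) then 2 else suc n) summand                   ≡⟨ cong (λ b → ∑ (if b then 2 else suc n) summand) odd-part ⟩
  podParity m n ℙ.+ ((q^ (1 * suc m) · podParity m) n ℙ.+ 0ℙ)      ≡⟨ cong (podParity m n ℙ.+_) (ℙ.+-identityʳ _) ⟩
  podParity m n ℙ.+ (q^ (1 * suc m) · podParity m) n               ≡⟨ cong (λ a → podParity m n ℙ.+ (q^ a · podParity m) n) (*-identityˡ (suc m)) ⟩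
  (⟨1+q^ suc m ⟩ podParity m) n                                    ∎
  where
  open ≡-Reasoning
  summand = λ j → (q^ (j * suc m) · podParity m) n

podParity-even : ∀ m → isOdd (suc m) ≡ false → ⟨1+q^ suc m ⟩ podParity (suc m) ≗ podParity m
podParity-even m even-part n = begin
  (⟨1+q^ suc m ⟩ podParity (suc m)) n                        ≡⟨ ⟨1+q^⟩-cong (suc m) generating-series n ⟩
  (⟨1+q^ suc m ⟩ ⟨∑q^ (_* suc m) ⟩ podParity m) n            ≡⟨ ⟨1+q^⟩-geometric (suc m) (podParity m) (s≤s z≤n) n ⟩
  podParity m n                                              ∎
  where
  open ≡-Reasoning
  generating-series : podParity (suc m) ≗ ⟨∑q^ (_* suc m) ⟩ podParity m
  generating-series k = trans (podParity-suc m k)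
    (cong (λ b → ∑ (if b then 2 else suc k) (λ j → (q^ (j * suc m) · podParity m) k)) even-part)

podParity-stable : ∀ m → podParity (suc m) ≈[ m ] podParity m
podParity-stable m = by-parity (isOdd (suc m)) refl
  where
  by-parity : ∀ b → isOdd (suc m) ≡ b → podParity (suc m) ≈[ m ] podParity m
  by-parity true  odd-part  = ≈-trans (≗⇒≈ (podParity-odd m odd-part)) (⟨1+q^⟩≈id (suc m) (podParity m) ≤-refl)
  by-parity false even-part = ≈-trans (≈-sym (⟨1+q^⟩≈id (suc m) (podParity (suc m)) ≤-refl))
                                      (≗⇒≈ (podParity-even m even-part))

podParity≡pod : ∀ {k m} → k ≤ m → podParity m k ≡ parity (pod k)
podParity≡pod {k} k≤m with m≤n⇒∃[o]m+o≡n k≤m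
... | i , refl = extra i
  where
  extra : ∀ i → podParity (k + i) k ≡ parity (pod k)
  extra zero    = cong (λ m → podParity m k) (+-identityʳ k)
  extra (suc i) = trans (cong (λ m → podParity m k) (+-suc k i))
                        (trans (podParity-stable (k + i) k (m≤m+n k i)) (extra i))

isOdd-odd : ∀ L → isOdd (odd L) ≡ true
isOdd-odd zero    = refl
isOdd-odd (suc L) = isOdd-odd L

isOdd-even : ∀ L → isOdd (even L) ≡ false
isOdd-even zero    = refl
isOdd-even (suc L) = isOdd-even L

even·podParity≗odd : ∀ L → ∏⟨1+q^ even ⟩ L (podParity (double L)) ≗ ∏⟨1+q^ odd ⟩ L 𝟙
even·podParity≗odd zero    = podParity-zero
even·podParity≗odd (suc L) n = begin
  (⟨1+q^ even L ⟩ E (podParity (even L))) n   ≡⟨ ∏-⟨1+q^⟩ (even L) even L (podParity (even L)) n ⟩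
  E (⟨1+q^ even L ⟩ podParity (even L)) n     ≡⟨ ∏-cong even L (podParity-even (odd L) (isOdd-even L)) n ⟩
  E (podParity (odd L)) n                     ≡⟨ ∏-cong even L (podParity-odd (double L) (isOdd-odd L)) n ⟩
  E (⟨1+q^ odd L ⟩ podParity (double L)) n    ≡⟨ ∏-⟨1+q^⟩ (odd L) even L (podParity (double L)) n ⟨
  (⟨1+q^ odd L ⟩ E (podParity (double L))) n  ≡⟨ ⟨1+q^⟩-cong (odd L) (even·podParity≗odd L) n ⟩
  (∏⟨1+q^ odd ⟩ (suc L) 𝟙) n                  ∎
  where
  open ≡-Reasoning
  E = ∏⟨1+q^ even ⟩ L

triSum-parity : ∀ {n m} → n ≤ m → parity (triSum n) ≡ (⟨∑q^ tri ⟩ podParity m) n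
triSum-parity {n} {m} n≤m = trans (parity-sum (suc n) (podShift n)) (∑-cong (suc n) (λ k _ → summand k))
  where
  summand : ∀ k → parity (podShift n k) ≡ (q^ tri k · podParity m) n
  summand k rewrite q^·-≤? (tri k) (podParity m) n with tri k ≤? n
  ... | no  _ = refl
  ... | yes _ = sym (podParity≡pod (≤-trans (m∸n≤m n (tri k)) n≤m))

ψ·podParity≈𝟙 : ∀ L → ⟨∑q^ tri ⟩ podParity (double L) ≈[ double L ] 𝟙
ψ·podParity≈𝟙 L = ∏-injective even L (λ _ → s≤s z≤n) (begin
  E (ψ P)     ≈⟨ ≗⇒≈ (⟨∑q^⟩-∏ k≤tri even L P) ⟨
  ψ (E P)     ≈⟨ ≗⇒≈ (⟨∑q^⟩-cong tri (even·podParity≗odd L)) ⟩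
  ψ (O 𝟙)     ≈⟨ ≗⇒≈ (⟨∑q^⟩-∏ k≤tri odd L 𝟙) ⟩
  O (ψ 𝟙)     ≈⟨ OddEven.gauss L (jacobi L) ⟩
  E 𝟙         ∎)
  where
  open ≈-Reasoning (double L)
  open OddEven L using (O; E)
  ψ = ⟨∑q^ tri ⟩_
  P = podParity (double L)

parity≡0ℙ⇒%2≡0 : ∀ x → parity x ≡ 0ℙ → x % 2 ≡ 0
parity≡0ℙ⇒%2≡0 zero          _      = refl
parity≡0ℙ⇒%2≡0 (suc zero)    ()
parity≡0ℙ⇒%2≡0 (suc (suc x)) even-x = parity≡0ℙ⇒%2≡0 x even-x

corollary3p2 : (n : ℕ) → 0 < n → triSum n % 2 ≡ 0
corollary3p2 (suc n) _ = parity≡0ℙ⇒%2≡0 (triSum (suc n)) (begin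
  parity (triSum (suc n))                               ≡⟨ triSum-parity (n≤double (suc n)) ⟩
  (⟨∑q^ tri ⟩ podParity (double (suc n))) (suc n)      ≡⟨ ψ·podParity≈𝟙 (suc n) (suc n) (n≤double (suc n)) ⟩
  𝟙 (suc n)                                             ∎)
  where open ≡-Reasoning
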